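{- Let $n\ge1$ and $p$ a prime. (1) If $n$ is odd or $p\neq2$, then $\mathcal{R}(n,p)\subseteq (Y_2\cap\mathcal{T})+Y_3$. (2) If $n$ is even and $p=2$, then $\mathcal{R}(n,p)\subseteq\langle\overline{B}_{[n/2,n/2]}\rangle+(Y_2\cap\mathcal{T})+Y_3$.
   Context: A composition of $n$ is a finite sequence $q=[a_1,\dots,a_s]$ of positive integers summing to $n$; $s$ is its number of components. For compositions $q=[a_1,\dots,a_s]$, $r=[b_1,\dots,b_t]$ of $n$, let $S(q,r)$ be the set of $s\times t$ matrices with non-negative integer entries whose $i$-th row sum is $a_i$ and $j$-th column sum is $b_j$. Let $\mathcal{Z}_n$ be the free $\mathbb{Z}$-module with basis $\{B_q\}$ indexed by compositions of $n$, with product $B_qB_r=\sum_{Z\in S(q,r)} B_{c(Z)}$, where $c(Z)$ is the composition obtained by reading the entries of $Z$ row by row and omitting zeros. $\Sigma(n,p)=\mathcal{Z}_n/p\mathcal{Z}_n$ over $\mathbb{F}_p$, with basis $\overline{B}_q$, and $\mathcal{R}(n,p)$ is its Jacobson radical. Write $q\approx r$ if $q,r$ differ only in the order of their components. $Y_m$ is the subspace of $\Sigma(n,p)$ spanned by all $\overline{B}_q$ with $q$ having at least $m$ components. $\mathcal{T}$ is the subspace of $\Sigma(n,p)$ spanned by all $\overline{B}_q-\overline{B}_r$ with $q\approx r$. -}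

module Defs where

open import Data.Nat using (ℕ; zero; suc; _+_; _*_; _∸_; _⊓_; _≤_; _≤?_; NonZero)
open import Data.Nat.DivMod using (_mod_)
open import Data.Nat.ListAction using (sum)
open import Data.Nat.Primality using (Prime; prime⇒nonZero)
open import Data.Bool using (Bool; true; false; if_then_else_)
open import Data.List using (List; []; _∷_; [_]; map; concat; concatMap; upTo; filter; length; allFin; zipWith)
import Data.List as L
open import Data.List.Properties using (≡-dec)
open import Data.List.Membership.Propositional using (_∈_)
open import Data.List.Relation.Binary.Permutation.Propositional using (_↭_)
open import Data.Vec using (Vec; tabulate; lookup) renaming (replicate to vreplicate; zipWith to vzipWith; map to vmap)
open import Data.Fin using (Fin; toℕ)
import Data.Fin as F
open import Data.Product using (Σ; ∃; _×_; _,_)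
open import Data.Sum using (_⊎_)
open import Relation.Binary.PropositionalEquality using (_≡_)
open import Relation.Nullary using (does)
import Data.Nat as N

rowsWith : ℕ → List ℕ → List (List ℕ)
rowsWith zero    []       = [ [] ]
rowsWith (suc _) []       = []
rowsWith a       (b ∷ bs) =
  concatMap (λ k → map (k ∷_) (rowsWith (a ∸ k) bs)) (upTo (suc (a ⊓ b)))

allZero : List ℕ → Bool
allZero []            = true
allZero (zero ∷ xs)   = allZero xs
allZero (suc _ ∷ _)   = false

-- matrices q r : the set S(q,r), each matrix given as its list of rows:
-- non-negative integer matrices with row sums q and column sums r.
matrices : List ℕ → List ℕ → List (List (List ℕ))
matrices []       cols = if allZero cols then [ [] ] else []
matrices (a ∷ as) cols =
  concatMap (λ v → map (v ∷_) (matrices as (zipWith _∸_ cols v))) (rowsWith a cols)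

isPos : ℕ → Bool
isPos zero    = false
isPos (suc _) = true

readComp : List (List ℕ) → List ℕ
readComp Z = L.filterᵇ isPos (concat Z)

-- compositions (with fuel); comps n = list of all compositions of n
compsF : ℕ → ℕ → List (List ℕ)
compsF _       zero    = [ [] ]
compsF zero    (suc n) = []
compsF (suc f) (suc n) =
  concatMap (λ k → map (suc k ∷_) (compsF f (n ∸ k))) (upTo (suc n))

comps : ℕ → List (List ℕ)
comps n = compsF n n

count : List ℕ → List (List ℕ) → ℕ
count c []       = 0
count c (d ∷ ds) = (if does (≡-dec N._≟_ c d) then 1 else 0) + count c ds

-- The algebra Σ(n,p) over F_p = Fin p (arithmetic mod p), with basis
-- indexed by the enumeration comps n; an element is its coefficient vector.

module Sigma (n p : ℕ) (pp : Prime p) where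

  instance
    nz : NonZero p
    nz = prime⇒nonZero pp

  d : ℕ
  d = length (comps n)

  compAt : Fin d → List ℕ
  compAt = L.lookup (comps n)

  Fp : Set
  Fp = Fin p

  fp : ℕ → Fp
  fp m = m mod p

  Elem : Set
  Elem = Vec Fp d

  0# : Elem
  0# = vreplicate d (fp 0)

  _+ₑ_ : Elem → Elem → Elem
  _+ₑ_ = vzipWith (λ a b → fp (toℕ a + toℕ b))

  _-ₑ_ : Elem → Elem → Elem
  _-ₑ_ = vzipWith (λ a b → fp (toℕ a + (p ∸ toℕ b)))

  _·ₑ_ : Fp → Elem → Elem
  c ·ₑ x = vmap (λ a → fp (toℕ c * toℕ a)) x

  -- the basis element \overline{B}_q (zero if q is not a composition of n)
  B : List ℕ → Elem
  B q = tabulate (λ j → if does (≡-dec N._≟_ (compAt j) q) then fp 1 else fp 0)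

  1# : Elem
  1# = B [ n ]

  -- product: B_q B_r = Σ_{Z ∈ S(q,r)} B_{c(Z)}, extended bilinearly
  _*ₑ_ : Elem → Elem → Elem
  x *ₑ y = tabulate λ k → fp (sum (concatMap (λ i → map (λ j →
      toℕ (lookup x i) * toℕ (lookup y j) *
      count (compAt k) (map readComp (matrices (compAt i) (compAt j))))
    (allFin d)) (allFin d)))

  -- subsets of Σ(n,p) as Bool-valued predicates (Σ(n,p) is finite)
  _⊆ᵇ_ : (Elem → Bool) → (Elem → Bool) → Set
  I ⊆ᵇ J = ∀ x → I x ≡ true → J x ≡ true

  record IsLeftIdeal (I : Elem → Bool) : Set where
    field
      zero-mem : I 0# ≡ true
      +-closed : ∀ x y → I x ≡ true → I y ≡ true → I (x +ₑ y) ≡ true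
      *-closed : ∀ a x → I x ≡ true → I (a *ₑ x) ≡ true

  record IsMaximalLeftIdeal (M : Elem → Bool) : Set where
    field
      isLeftIdeal : IsLeftIdeal M
      proper      : M 1# ≡ false
      maximal     : ∀ I → IsLeftIdeal I → M ⊆ᵇ I → (I ⊆ᵇ M) ⊎ (I 1# ≡ true)

  Rad : Elem → Set
  Rad x = ∀ M → IsMaximalLeftIdeal M → M x ≡ true

  Span : (Elem → Set) → Elem → Set
  Span G x = Σ (List (Fp × Σ Elem G)) λ L →
    x ≡ L.foldr (λ { (c , g , _) acc → (c ·ₑ g) +ₑ acc }) 0# L

  Y : ℕ → Elem → Set
  Y m = Span (λ g → Σ (List ℕ) λ q → q ∈ comps n × m ≤ length q × g ≡ B q)

  T : Elem → Set
  T = Span (λ g → Σ (List ℕ) λ q → Σ (List ℕ) λ r →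
        q ∈ comps n × r ∈ comps n × q ↭ r × g ≡ (B q -ₑ B r))

  ⟨_⟩ : Elem → Elem → Set
  ⟨ v ⟩ = Span (λ g → g ≡ v)

  _∩_ : (Elem → Set) → (Elem → Set) → Elem → Set
  (U ∩ W) x = U x × W x

  _⊕_ : (Elem → Set) → (Elem → Set) → Elem → Set
  (U ⊕ W) x = Σ Elem λ u → Σ Elem λ w → U u × W w × x ≡ (u +ₑ w)

  infixl 6 _⊕_
  infixl 7 _∩_

module Submission where

-- An algebra homomorphism χ : Σ(n,p) → F_p has a maximal
-- left ideal as kernel, so it kills the radical R(n,p).  For a weight w on
-- compositions put χ_w(Σ x_q B_q) = Σ w(q) x_q.  If w vanishes on compositions
-- with ≥ 3 parts, w[n] = 1 and w[x,y] w[u,v] = w[x,y] (δ_{xu} + δ_{xv}) on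
-- two-part compositions, then Σ_{Z ∈ S(q,r)} w(c(Z)) = w(q) w(r) (only 1×k,
-- k×1 and 2×2 matrices matter), so χ_w is multiplicative.  This applies to
-- w₀ = δ_[n] and w_a = δ_[n] + δ_[a,n-a] + δ_[n-a,a], giving x_[n] = 0 and
-- x_[s,t] + x_[t,s] = 0 for x ∈ R(n,p).  Hence x is its two-part component, an
-- antisymmetric combination lying in Y₂ ∩ T (apart from the coefficient of
-- [n/2,n/2], which vanishes unless n is even and p = 2), plus a part in Y₃.

open import Defs
open import Data.Nat using (ℕ; _≤_; _/_)
open import Data.Nat.Divisibility using (_∣_)
open import Data.Nat.Primality using (Prime)
open import Data.List using (_∷_; [])
open import Data.Product using (_×_)
open import Data.Sum using (_⊎_)
open import Relation.Nullary using (¬_)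
open import Relation.Binary.PropositionalEquality using (_≡_; _≢_)

open import Data.Nat
  using (zero; suc; _+_; _*_; _∸_; _<_; _⊓_; _%_; _≡ᵇ_; _<ᵇ_; _≤ᵇ_; z≤n; s≤s; NonZero; pred; ≢-nonZero; nonTrivial⇒n>1)
open import Data.Nat.Properties
open import Data.Nat.DivMod
  using (_mod_; %-distribˡ-+; %-distribˡ-*; m%n%n≡m%n; [m+kn]%n≡m%n; m*n%n≡0; n%n≡0; m<n⇒m%n≡m; m%n<n; m*n/n≡m)
open import Data.Nat.Divisibility using (divides; m%n≡0⇒n∣m; n∣m⇒m%n≡0; ∣⇒≤)
open import Data.Nat.GCD using (module Bézout)
open import Data.Nat.Coprimality using (prime⇒coprime; coprime-Bézout)
open import Data.Nat.Primality using (prime⇒nonTrivial; euclidsLemma)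
open import Data.Nat.ListAction using (sum)
open import Data.Nat.ListAction.Properties using (sum-++)
open import Data.Nat.Solver using (module +-*-Solver)
open import Algebra.Properties.CommutativeSemigroup +-commutativeSemigroup using (interchange)
open import Data.Bool using (Bool; true; false; if_then_else_; not) renaming (T to IsTrue)
open import Data.Unit using (tt; ⊤)
open import Data.Empty using (⊥; ⊥-elim)
open import Data.List
  using (List; map; concat; concatMap; applyUpTo; upTo; allFin; length; zipWith; _++_; filterᵇ; tabulate)
import Data.List as L
open import Data.List.Properties using (≡-dec; map-++; map-tabulate; ∷-injectiveˡ; ∷-injectiveʳ; ++-identityʳ)
open import Data.List.Relation.Unary.All as All using (All; []; _∷_)
open import Data.List.Relation.Unary.All.Properties using (map⁺; concat⁺; all-upTo)
open import Data.List.Relation.Unary.Any using (here; there)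
open import Data.List.Membership.Propositional using (_∈_)
open import Data.List.Membership.Propositional.Properties using (∈-lookup)
open import Data.List.Relation.Binary.Permutation.Propositional using (_↭_; ↭-refl; ↭-swap)
open import Data.Fin using (Fin; toℕ)
import Data.Fin as F
import Data.Fin.Properties as FP
import Data.Vec as V
import Data.Vec.Properties as VP
open import Data.Product using (Σ; _,_; proj₁; proj₂)
open import Data.Sum using (inj₁; inj₂)
open import Relation.Nullary using (Dec; yes; no; does)
open import Relation.Nullary.Decidable using (dec-true; dec-false)
open import Relation.Binary.Definitions using (tri<; tri≈; tri>)
open import Relation.Binary.PropositionalEquality
  using (refl; sym; trans; cong; cong₂; subst; module ≡-Reasoning)

private variable
  A C : Set

sum-map-+ : (f g : A → ℕ) (xs : List A) →
  sum (map (λ x → f x + g x) xs) ≡ sum (map f xs) + sum (map g xs)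
sum-map-+ f g [] = refl
sum-map-+ f g (x ∷ xs) rewrite sum-map-+ f g xs = interchange (f x) (g x) _ _

sum-map-*ˡ : (c : ℕ) (f : A → ℕ) (xs : List A) → c * sum (map f xs) ≡ sum (map (λ x → c * f x) xs)
sum-map-*ˡ c f [] = *-zeroʳ c
sum-map-*ˡ c f (x ∷ xs) rewrite sym (sum-map-*ˡ c f xs) = *-distribˡ-+ c (f x) _

sum-map-*ʳ : (c : ℕ) (f : A → ℕ) (xs : List A) → sum (map f xs) * c ≡ sum (map (λ x → f x * c) xs)
sum-map-*ʳ c f [] = refl
sum-map-*ʳ c f (x ∷ xs) rewrite sym (sum-map-*ʳ c f xs) = *-distribʳ-+ c (f x) _

sum-map-cong : {f g : A → ℕ} → (∀ x → f x ≡ g x) → (xs : List A) → sum (map f xs) ≡ sum (map g xs)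
sum-map-cong e [] = refl
sum-map-cong e (x ∷ xs) = cong₂ _+_ (e x) (sum-map-cong e xs)

sum-map-cong-All : {f g : A → ℕ} (xs : List A) → All (λ x → f x ≡ g x) xs → sum (map f xs) ≡ sum (map g xs)
sum-map-cong-All [] [] = refl
sum-map-cong-All (x ∷ xs) (e ∷ es) = cong₂ _+_ e (sum-map-cong-All xs es)

sum-map-zero : (f : A → ℕ) (xs : List A) → All (λ x → f x ≡ 0) xs → sum (map f xs) ≡ 0
sum-map-zero f [] [] = refl
sum-map-zero f (x ∷ xs) (e ∷ es) rewrite e = sum-map-zero f xs es

sum-map-concatMap : (f : C → ℕ) (g : A → List C) (xs : List A) →
  sum (map f (concatMap g xs)) ≡ sum (map (λ x → sum (map f (g x))) xs)
sum-map-concatMap f g [] = refl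
sum-map-concatMap f g (x ∷ xs) =
  trans (cong sum (map-++ f (g x) (concatMap g xs)))
    (trans (sum-++ (map f (g x)) _) (cong (sum (map f (g x)) +_) (sum-map-concatMap f g xs)))

sum-concatMap : (g : A → List ℕ) (xs : List A) → sum (concatMap g xs) ≡ sum (map (λ x → sum (g x)) xs)
sum-concatMap g [] = refl
sum-concatMap g (x ∷ xs) = trans (sum-++ (g x) (concatMap g xs)) (cong (sum (g x) +_) (sum-concatMap g xs))

sum-map-map : (f : C → ℕ) (g : A → C) (xs : List A) → sum (map f (map g xs)) ≡ sum (map (λ x → f (g x)) xs)
sum-map-map f g [] = refl
sum-map-map f g (x ∷ xs) = cong (f (g x) +_) (sum-map-map f g xs)

sum-swap : (h : A → C → ℕ) (xs : List A) (ys : List C) →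
  sum (map (λ a → sum (map (h a) ys)) xs) ≡ sum (map (λ b → sum (map (λ a → h a b) xs)) ys)
sum-swap h [] ys = sym (sum-map-zero _ ys (All.universal (λ _ → refl) ys))
sum-swap h (x ∷ xs) ys = trans (cong (sum (map (h x) ys) +_) (sum-swap h xs ys))
  (sym (sum-map-+ (h x) (λ b → sum (map (λ a → h a b) xs)) ys))

sum-allFin : (f : A → ℕ) (xs : List A) →
  sum (map (λ k → f (L.lookup xs k)) (allFin (length xs))) ≡ sum (map f xs)
sum-allFin f xs = trans (cong sum (map-tabulate (λ k → k) (λ k → f (L.lookup xs k)))) (by-positions xs)
  where
  by-positions : (xs : List _) → sum (tabulate (λ k → f (L.lookup xs k))) ≡ sum (map f xs)
  by-positions [] = refl
  by-positions (x ∷ xs) = cong (f x +_) (by-positions xs)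

sum-allFin-point : ∀ m (g : Fin m → ℕ) (j : Fin m) → (∀ k → k ≢ j → g k ≡ 0) → sum (map g (allFin m)) ≡ g j
sum-allFin-point (suc m) g j h = trans (cong sum (map-tabulate (λ k → k) g)) (single j h)
  where
  tail0 : ∀ {m} (g : Fin (suc m) → ℕ) → (∀ k → g (F.suc k) ≡ 0) → sum (tabulate (λ k → g (F.suc k))) ≡ 0
  tail0 g z = trans (cong sum (sym (map-tabulate (λ k → k) (λ k → g (F.suc k)))))
                (sum-map-zero _ (allFin _) (All.universal z _))
  single : ∀ {m} {g : Fin m → ℕ} (j : Fin m) → (∀ k → k ≢ j → g k ≡ 0) → sum (tabulate g) ≡ g j
  single {g = g} F.zero h = trans (cong (g F.zero +_) (tail0 g (λ k → h (F.suc k) (λ ())))) (+-identityʳ _)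
  single {g = g} (F.suc j) h = trans (cong (_+ sum (tabulate (λ k → g (F.suc k)))) (h F.zero (λ ())))
    (single {g = λ k → g (F.suc k)} j (λ k ne → h (F.suc k) (λ e → ne (FP.suc-injective e))))

sumBelow : (ℕ → ℕ) → ℕ → ℕ
sumBelow g zero = 0
sumBelow g (suc N) = g 0 + sumBelow (λ k → g (suc k)) N

sum-applyUpTo : (H : ℕ → ℕ) (f : ℕ → ℕ) (N : ℕ) → sum (map H (applyUpTo f N)) ≡ sumBelow (λ k → H (f k)) N
sum-applyUpTo H f zero = refl
sum-applyUpTo H f (suc N) = cong (H (f 0) +_) (sum-applyUpTo H (λ k → f (suc k)) N)

sum-upTo : (H : ℕ → ℕ) (N : ℕ) → sum (map H (upTo N)) ≡ sumBelow H N
sum-upTo H N = sum-applyUpTo H (λ k → k) N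

sumBelow-cong : {g g' : ℕ → ℕ} (N : ℕ) → (∀ k → k < N → g k ≡ g' k) → sumBelow g N ≡ sumBelow g' N
sumBelow-cong zero e = refl
sumBelow-cong (suc N) e = cong₂ _+_ (e 0 (s≤s z≤n)) (sumBelow-cong N (λ k k<N → e (suc k) (s≤s k<N)))

sumBelow-+ : (g h : ℕ → ℕ) (N : ℕ) → sumBelow (λ k → g k + h k) N ≡ sumBelow g N + sumBelow h N
sumBelow-+ g h zero = refl
sumBelow-+ g h (suc N) rewrite sumBelow-+ (λ k → g (suc k)) (λ k → h (suc k)) N = interchange (g 0) (h 0) _ _

ind : Bool → ℕ → ℕ
ind true c = c
ind false c = 0

ind-0 : (b : Bool) → ind b 0 ≡ 0
ind-0 true = refl
ind-0 false = refl

ind-cong : (b : Bool) {c c' : ℕ} → c ≡ c' → ind b c ≡ ind b c'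
ind-cong b refl = refl

ind-* : (b : Bool) (x : ℕ) → x * ind b 1 ≡ ind b x
ind-* true x = *-identityʳ x
ind-* false x = *-zeroʳ x

sum-ind : (b : Bool) (H : A → ℕ) (xs : List A) → sum (map (λ x → ind b (H x)) xs) ≡ ind b (sum (map H xs))
sum-ind true H xs = refl
sum-ind false H xs = sum-map-zero _ xs (All.universal (λ _ → refl) xs)

sumBelow-point : (b c N : ℕ) → sumBelow (λ k → ind (k ≡ᵇ b) c) N ≡ ind (b <ᵇ N) c
sumBelow-point zero c zero = refl
sumBelow-point zero c (suc N) = trans (cong (c +_) (zeroes N)) (+-identityʳ c)
  where
  zeroes : ∀ N → sumBelow (λ k → ind (suc k ≡ᵇ 0) c) N ≡ 0
  zeroes zero = refl
  zeroes (suc N) = zeroes N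
sumBelow-point (suc b) c zero = refl
sumBelow-point (suc b) c (suc N) = sumBelow-point b c N

IsTrue⇒≡true : ∀ {b} → IsTrue b → b ≡ true
IsTrue⇒≡true {true} _ = refl

¬IsTrue⇒≡false : ∀ {b} → ¬ IsTrue b → b ≡ false
¬IsTrue⇒≡false {false} _ = refl
¬IsTrue⇒≡false {true} f = ⊥-elim (f tt)

≡true⇒IsTrue : ∀ {b} → b ≡ true → IsTrue b
≡true⇒IsTrue refl = tt

Bool-ext : {b b' : Bool} → (b ≡ true → b' ≡ true) → (b' ≡ true → b ≡ true) → b ≡ b'
Bool-ext {false} {false} f g = refl
Bool-ext {false} {true} f g = g refl
Bool-ext {true} {false} f g = sym (f refl)
Bool-ext {true} {true} f g = refl

≡ᵇ-refl : ∀ m → (m ≡ᵇ m) ≡ true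
≡ᵇ-refl m = IsTrue⇒≡true (≡⇒≡ᵇ m m refl)

≡ᵇ-≢ : ∀ {m n} → m ≢ n → (m ≡ᵇ n) ≡ false
≡ᵇ-≢ {m} {n} ne = ¬IsTrue⇒≡false (λ t → ne (≡ᵇ⇒≡ m n t))

≡ᵇ-sound : ∀ {m n} → (m ≡ᵇ n) ≡ true → m ≡ n
≡ᵇ-sound {m} {n} e = ≡ᵇ⇒≡ m n (≡true⇒IsTrue e)

≡ᵇ-sym : (x y : ℕ) → (x ≡ᵇ y) ≡ (y ≡ᵇ x)
≡ᵇ-sym x y = Bool-ext (λ e → IsTrue⇒≡true (≡⇒≡ᵇ y x (sym (≡ᵇ-sound {x} {y} e))))
                      (λ e → IsTrue⇒≡true (≡⇒≡ᵇ x y (sym (≡ᵇ-sound {y} {x} e))))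

<ᵇ-complete : ∀ {m n} → m < n → (m <ᵇ n) ≡ true
<ᵇ-complete lt = IsTrue⇒≡true (<⇒<ᵇ lt)

eqL : List ℕ → List ℕ → Bool
eqL c d = does (≡-dec _≟_ c d)

indL : List ℕ → List ℕ → ℕ
indL c d = ind (eqL c d) 1

indL-yes : (c : List ℕ) → indL c c ≡ 1
indL-yes c rewrite dec-true (≡-dec _≟_ c c) refl = refl

indL-no : (c d : List ℕ) → c ≢ d → indL c d ≡ 0
indL-no c d ne rewrite dec-false (≡-dec _≟_ c d) ne = refl

indL-sym : (c d : List ℕ) → indL c d ≡ indL d c
indL-sym c d = by-cases (≡-dec _≟_ c d)
  where
  by-cases : Dec (c ≡ d) → indL c d ≡ indL d c
  by-cases (yes refl) = refl
  by-cases (no ne) = trans (indL-no c d ne) (sym (indL-no d c (λ e → ne (sym e))))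

indL-pair : (x y a b : ℕ) → x + y ≡ a + b → indL (x ∷ y ∷ []) (a ∷ b ∷ []) ≡ ind (x ≡ᵇ a) 1
indL-pair x y a b e with x ≟ a
... | yes refl rewrite +-cancelˡ-≡ x y b e | ≡ᵇ-refl x | ≡ᵇ-refl b = refl
... | no ne = trans (indL-no (x ∷ y ∷ []) (a ∷ b ∷ []) (λ eq → ne (∷-injectiveˡ eq))) (sym (cong (λ z → ind z 1) (≡ᵇ-≢ ne)))

indL-long : (c d : List ℕ) → 3 ≤ length c → length d < 3 → indL c d ≡ 0
indL-long c d h l = indL-no c d (λ e → <⇒≱ l (subst (λ z → 3 ≤ length z) e h))

if-as-ind : (b : Bool) → (if b then 1 else 0) ≡ ind b 1
if-as-ind true = refl
if-as-ind false = refl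

sum-indL : (G : List ℕ → ℕ) (c : List ℕ) (Ls : List (List ℕ)) → sum (map (λ e → G e * indL e c) Ls) ≡ G c * count c Ls
sum-indL G c [] = sym (*-zeroʳ (G c))
sum-indL G c (e ∷ Ls) = trans (cong₂ _+_ (head (≡-dec _≟_ c e)) (sum-indL G c Ls)) (sym (*-distribˡ-+ (G c) _ (count c Ls)))
  where
  head : Dec (c ≡ e) → G e * indL e c ≡ G c * (if eqL c e then 1 else 0)
  head (yes refl) = cong (G c *_) (sym (if-as-ind (eqL c c)))
  head (no ne) rewrite indL-no e c (λ x → ne (sym x)) | if-as-ind (eqL c e) | indL-no c e ne =
    trans (*-zeroʳ (G e)) (sym (*-zeroʳ (G c)))

count-as-sum : (e : List ℕ) (Ls : List (List ℕ)) → count e Ls ≡ sum (map (indL e) Ls)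
count-as-sum e [] = refl
count-as-sum e (c ∷ Ls) = cong₂ _+_ (if-as-ind (eqL e c)) (count-as-sum e Ls)

-- The enumeration of S(q,r).

_≤*_ : List ℕ → List ℕ → Set
[] ≤* [] = ⊤
[] ≤* (_ ∷ _) = ⊥
(_ ∷ _) ≤* [] = ⊥
(x ∷ xs) ≤* (y ∷ ys) = (x ≤ y) × (xs ≤* ys)

IsRow : ℕ → List ℕ → List ℕ → Set
IsRow a bs v = (sum v ≡ a) × (v ≤* bs)

All-concatMap : {P : C → Set} (g : A → List C) (xs : List A) → All (λ x → All P (g x)) xs → All P (concatMap g xs)
All-concatMap g xs a = concat⁺ (map⁺ a)

rowsWith-sound : (a : ℕ) (bs : List ℕ) → All (IsRow a bs) (rowsWith a bs)
rowsWith-sound-cons : (a b : ℕ) (bs : List ℕ) →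
  All (IsRow a (b ∷ bs)) (concatMap (λ k → map (k ∷_) (rowsWith (a ∸ k) bs)) (upTo (suc (a ⊓ b))))
rowsWith-sound zero [] = (refl , tt) ∷ []
rowsWith-sound (suc a) [] = []
rowsWith-sound zero (b ∷ bs) = rowsWith-sound-cons zero b bs
rowsWith-sound (suc a) (b ∷ bs) = rowsWith-sound-cons (suc a) b bs
rowsWith-sound-cons a b bs = All-concatMap _ (upTo (suc (a ⊓ b))) (All.map (λ {k} → extend k) (all-upTo (suc (a ⊓ b))))
  where
  extend : ∀ k → k < suc (a ⊓ b) → All (IsRow a (b ∷ bs)) (map (k ∷_) (rowsWith (a ∸ k) bs))
  extend k (s≤s k≤) = map⁺ (All.map (λ (s , le) →
     trans (cong (k +_) s) (m+[n∸m]≡n (≤-trans k≤ (m⊓n≤m a b))) , ≤-trans k≤ (m⊓n≤n a b) , le) (rowsWith-sound (a ∸ k) bs))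

sum-∸-row : (bs vs : List ℕ) → vs ≤* bs → sum (zipWith _∸_ bs vs) + sum vs ≡ sum bs
sum-∸-row [] [] _ = refl
sum-∸-row (b ∷ bs) (v ∷ vs) (v≤b , le) =
  trans (interchange (b ∸ v) _ v (sum vs)) (cong₂ _+_ (m∸n+n≡m v≤b) (sum-∸-row bs vs le))

ind-allZero-cons : (x : ℕ) (r : List ℕ) (c : ℕ) → ind (allZero (x ∷ r)) c ≡ ind (x ≡ᵇ 0) (ind (allZero r) c)
ind-allZero-cons zero r c = refl
ind-allZero-cons (suc x) r c = refl

-- Among the rows of total a under bounds bs, only bs itself exhausts the bounds.
sum-rowsWith-exhausting : (a : ℕ) (bs : List ℕ) (G : List ℕ → ℕ) →
  sum (map (λ v → ind (allZero (zipWith _∸_ bs v)) (G v)) (rowsWith a bs)) ≡ ind (sum bs ≡ᵇ a) (G bs)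
sum-rowsWith-exhausting-cons : (a b : ℕ) (bs : List ℕ) (G : List ℕ → ℕ) →
  sum (map (λ v → ind (allZero (zipWith _∸_ (b ∷ bs) v)) (G v))
    (concatMap (λ k → map (k ∷_) (rowsWith (a ∸ k) bs)) (upTo (suc (a ⊓ b))))) ≡ ind (b + sum bs ≡ᵇ a) (G (b ∷ bs))
sum-rowsWith-exhausting zero [] G = +-identityʳ _
sum-rowsWith-exhausting (suc a) [] G = refl
sum-rowsWith-exhausting zero (b ∷ bs) G = sum-rowsWith-exhausting-cons zero b bs G
sum-rowsWith-exhausting (suc a) (b ∷ bs) G = sum-rowsWith-exhausting-cons (suc a) b bs G
sum-rowsWith-exhausting-cons a b bs G =
  begin
    _ ≡⟨ sum-map-concatMap F (λ k → map (k ∷_) (rowsWith (a ∸ k) bs)) (upTo N) ⟩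
    sum (map (λ k → sum (map F (map (k ∷_) (rowsWith (a ∸ k) bs)))) (upTo N))
      ≡⟨ sum-map-cong (λ k → trans (sum-map-map F (k ∷_) (rowsWith (a ∸ k) bs)) (first-entry k)) (upTo N) ⟩
    sum (map Tk (upTo N)) ≡⟨ sum-upTo Tk N ⟩
    sumBelow Tk N ≡⟨ sumBelow-cong N only-b ⟩
    sumBelow (λ k → ind (k ≡ᵇ b) Cb) N ≡⟨ sumBelow-point b Cb N ⟩
    ind (b <ᵇ N) Cb ≡⟨ in-range ⟩
    ind (b + sum bs ≡ᵇ a) (G (b ∷ bs)) ∎
  where
  open ≡-Reasoning
  N = suc (a ⊓ b)
  F : List ℕ → ℕ
  F v = ind (allZero (zipWith _∸_ (b ∷ bs) v)) (G v)
  Tk : ℕ → ℕ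
  Tk k = ind (b ∸ k ≡ᵇ 0) (ind (sum bs ≡ᵇ a ∸ k) (G (k ∷ bs)))
  Cb : ℕ
  Cb = ind (sum bs ≡ᵇ a ∸ b) (G (b ∷ bs))
  first-entry : ∀ k → sum (map (λ v → F (k ∷ v)) (rowsWith (a ∸ k) bs)) ≡ Tk k
  first-entry k = begin
    sum (map (λ v → F (k ∷ v)) (rowsWith (a ∸ k) bs))
      ≡⟨ sum-map-cong (λ v → ind-allZero-cons (b ∸ k) (zipWith _∸_ bs v) (G (k ∷ v))) (rowsWith (a ∸ k) bs) ⟩
    sum (map (λ v → ind (b ∸ k ≡ᵇ 0) (ind (allZero (zipWith _∸_ bs v)) (G (k ∷ v)))) (rowsWith (a ∸ k) bs))
      ≡⟨ sum-ind (b ∸ k ≡ᵇ 0) _ (rowsWith (a ∸ k) bs) ⟩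
    ind (b ∸ k ≡ᵇ 0) (sum (map (λ v → ind (allZero (zipWith _∸_ bs v)) (G (k ∷ v))) (rowsWith (a ∸ k) bs)))
      ≡⟨ ind-cong (b ∸ k ≡ᵇ 0) (sum-rowsWith-exhausting (a ∸ k) bs (λ v → G (k ∷ v))) ⟩
    Tk k ∎
  only-b : ∀ k → k < N → Tk k ≡ ind (k ≡ᵇ b) Cb
  only-b k (s≤s k≤) with k ≟ b
  ... | yes refl rewrite n∸n≡0 k | ≡ᵇ-refl k = refl
  ... | no k≢b rewrite ≡ᵇ-≢ k≢b with b ∸ k | m>n⇒m∸n≢0 (≤∧≢⇒< (≤-trans k≤ (m⊓n≤n a b)) k≢b)
  ...   | zero | h = ⊥-elim (h refl)
  ...   | suc _ | h = refl
  in-range : ind (b <ᵇ N) Cb ≡ ind (b + sum bs ≡ᵇ a) (G (b ∷ bs))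
  in-range with b ≤? a
  ... | yes b≤a rewrite m≥n⇒m⊓n≡n b≤a | <ᵇ-complete (n<1+n b) =
     cong (λ z → ind z (G (b ∷ bs))) (Bool-ext
       (λ e → IsTrue⇒≡true (≡⇒≡ᵇ _ _ (trans (cong (b +_) (≡ᵇ-sound e)) (m+[n∸m]≡n b≤a))))
       (λ e → IsTrue⇒≡true (≡⇒≡ᵇ _ _ (trans (sym (m+n∸m≡n b (sum bs))) (cong (_∸ b) (≡ᵇ-sound e))))))
  ... | no b≰a rewrite m≤n⇒m⊓n≡m (≤-trans (n≤1+n a) (≰⇒> b≰a)) =
     trans (cong (λ z → ind z Cb) (¬IsTrue⇒≡false (λ t → b≰a (≤-pred (<ᵇ⇒< b (suc a) t)))))
       (sym (cong (λ z → ind z (G (b ∷ bs))) (≡ᵇ-≢ (λ e → b≰a (≤-trans (m≤m+n b (sum bs)) (≤-reflexive e))))))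

-- A single column of bound b admits the row [a] iff a ≤ b; this is the
-- test a <ᵇ suc (a ⊓ b) produced by the enumeration.
sum-rowsWith-single : (a b : ℕ) (G : List ℕ → ℕ) → sum (map G (rowsWith a (b ∷ []))) ≡ ind (a <ᵇ suc (a ⊓ b)) (G (a ∷ []))
sum-rowsWith-single-cons : (a b : ℕ) (G : List ℕ → ℕ) →
  sum (map G (concatMap (λ k → map (k ∷_) (rowsWith (a ∸ k) [])) (upTo (suc (a ⊓ b))))) ≡ ind (a <ᵇ suc (a ⊓ b)) (G (a ∷ []))
sum-rowsWith-single zero b G = sum-rowsWith-single-cons zero b G
sum-rowsWith-single (suc a) b G = sum-rowsWith-single-cons (suc a) b G
sum-rowsWith-single-cons a b G =
  begin
    _ ≡⟨ sum-map-concatMap G (λ k → map (k ∷_) (rowsWith (a ∸ k) [])) (upTo N) ⟩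
    sum (map (λ k → sum (map G (map (k ∷_) (rowsWith (a ∸ k) []))))  (upTo N)) ≡⟨ sum-upTo _ N ⟩
    sumBelow (λ k → sum (map G (map (k ∷_) (rowsWith (a ∸ k) [])))) N ≡⟨ sumBelow-cong N only-a ⟩
    sumBelow (λ k → ind (k ≡ᵇ a) (G (a ∷ []))) N ≡⟨ sumBelow-point a _ N ⟩
    _ ∎
  where
  open ≡-Reasoning
  N = suc (a ⊓ b)
  only-a : ∀ k → k < N → sum (map G (map (k ∷_) (rowsWith (a ∸ k) []))) ≡ ind (k ≡ᵇ a) (G (a ∷ []))
  only-a k (s≤s k≤) with k ≟ a
  ... | yes refl rewrite n∸n≡0 k | ≡ᵇ-refl k = +-identityʳ _
  ... | no k≢a rewrite ≡ᵇ-≢ k≢a with a ∸ k | m>n⇒m∸n≢0 (≤∧≢⇒< (≤-trans k≤ (m⊓n≤m a b)) k≢a)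
  ...   | zero | h = ⊥-elim (h refl)
  ...   | suc _ | h = refl

fits-true : (m b : ℕ) → m ≤ b → (m <ᵇ suc (m ⊓ b)) ≡ true
fits-true m b m≤b rewrite m≤n⇒m⊓n≡m m≤b = <ᵇ-complete (n<1+n m)

fits-false : (m b : ℕ) → b < m → (m <ᵇ suc (m ⊓ b)) ≡ false
fits-false m b b<m rewrite m≥n⇒m⊓n≡n (<⇒≤ b<m) = ¬IsTrue⇒≡false (λ t → <⇒≱ b<m (≤-pred (<ᵇ⇒< m (suc b) t)))

sum-matrices-oneRow : (a : ℕ) (bs : List ℕ) (F : List (List ℕ) → ℕ) →
  sum (map F (matrices (a ∷ []) bs)) ≡ ind (sum bs ≡ᵇ a) (F (bs ∷ []))
sum-matrices-oneRow a bs F =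
  begin
    _ ≡⟨ sum-map-concatMap F _ (rowsWith a bs) ⟩
    _ ≡⟨ sum-map-cong last-row (rowsWith a bs) ⟩
    _ ≡⟨ sum-rowsWith-exhausting a bs (λ v → F (v ∷ [])) ⟩
    _ ∎
  where
  open ≡-Reasoning
  last-row : ∀ v → sum (map F (map (v ∷_) (matrices [] (zipWith _∸_ bs v)))) ≡ ind (allZero (zipWith _∸_ bs v)) (F (v ∷ []))
  last-row v with allZero (zipWith _∸_ bs v)
  ... | true = +-identityʳ _
  ... | false = refl

-- A matrix in S([a₁,a₂], r) is determined by its first row v; the second is r - v.
sum-matrices-twoRows : (a₁ a₂ : ℕ) (bs : List ℕ) (F : List (List ℕ) → ℕ) → sum bs ≡ a₁ + a₂ →
  sum (map F (matrices (a₁ ∷ a₂ ∷ []) bs)) ≡ sum (map (λ v → F (v ∷ zipWith _∸_ bs v ∷ [])) (rowsWith a₁ bs))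
sum-matrices-twoRows a₁ a₂ bs F sb =
  trans (sum-map-concatMap F _ (rowsWith a₁ bs))
    (sum-map-cong-All (rowsWith a₁ bs) (All.map (λ {v} → second-row v) (rowsWith-sound a₁ bs)))
  where
  second-row : ∀ v → IsRow a₁ bs v →
    sum (map F (map (v ∷_) (matrices (a₂ ∷ []) (zipWith _∸_ bs v)))) ≡ F (v ∷ zipWith _∸_ bs v ∷ [])
  second-row v (sv , le) =
    trans (sum-map-map F (v ∷_) (matrices (a₂ ∷ []) (zipWith _∸_ bs v)))
      (trans (sum-matrices-oneRow a₂ (zipWith _∸_ bs v) (λ Z → F (v ∷ Z)))
        (cong (λ z → ind z (F (v ∷ zipWith _∸_ bs v ∷ []))) (IsTrue⇒≡true (≡⇒≡ᵇ _ _ rest-sum))))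
    where
    rest-sum : sum (zipWith _∸_ bs v) ≡ a₂
    rest-sum = +-cancelʳ-≡ a₁ _ _ (trans (trans (cong (sum (zipWith _∸_ bs v) +_) (sym sv)) (sum-∸-row bs v le))
                 (trans sb (+-comm a₁ a₂)))

-- Number of non-zero entries of a list; it is the number of parts of c(Z).
nonzeros : List ℕ → ℕ
nonzeros [] = 0
nonzeros (zero ∷ xs) = nonzeros xs
nonzeros (suc _ ∷ xs) = suc (nonzeros xs)

length-filter-isPos : (xs : List ℕ) → length (filterᵇ isPos xs) ≡ nonzeros xs
length-filter-isPos [] = refl
length-filter-isPos (zero ∷ xs) = length-filter-isPos xs
length-filter-isPos (suc x ∷ xs) = cong suc (length-filter-isPos xs)

nonzeros-++ : (xs ys : List ℕ) → nonzeros (xs ++ ys) ≡ nonzeros xs + nonzeros ys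
nonzeros-++ [] ys = refl
nonzeros-++ (zero ∷ xs) ys = nonzeros-++ xs ys
nonzeros-++ (suc x ∷ xs) ys = cong suc (nonzeros-++ xs ys)

nonzeros-sum : (v : List ℕ) → 1 ≤ sum v → 1 ≤ nonzeros v
nonzeros-sum (zero ∷ v) h = nonzeros-sum v h
nonzeros-sum (suc x ∷ v) h = s≤s z≤n

nonzeros-split : (c v : List ℕ) → v ≤* c → nonzeros c ≤ nonzeros v + nonzeros (zipWith _∸_ c v)
nonzeros-split [] [] _ = z≤n
nonzeros-split (zero ∷ c) (zero ∷ v) (_ , le) = nonzeros-split c v le
nonzeros-split (suc x ∷ c) (zero ∷ v) (_ , le) =
  subst (suc (nonzeros c) ≤_) (sym (+-suc (nonzeros v) (nonzeros (zipWith _∸_ c v)))) (s≤s (nonzeros-split c v le))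
nonzeros-split (suc x ∷ c) (suc y ∷ v) (_ , le) =
  s≤s (≤-trans (nonzeros-split c v le) (+-monoʳ-≤ (nonzeros v) (nonzeros-cons (x ∸ y) (zipWith _∸_ c v))))
  where
  nonzeros-cons : ∀ z r → nonzeros r ≤ nonzeros (z ∷ r)
  nonzeros-cons zero r = ≤-refl
  nonzeros-cons (suc z) r = n≤1+n _

allZero⇒nonzeros≡0 : (c : List ℕ) → allZero c ≡ true → nonzeros c ≡ 0
allZero⇒nonzeros≡0 [] _ = refl
allZero⇒nonzeros≡0 (zero ∷ c) e = allZero⇒nonzeros≡0 c e

-- every non-zero row sum contributes a non-zero entry
matrices-rowBound : (q cols : List ℕ) → All (λ Z → nonzeros q ≤ nonzeros (concat Z)) (matrices q cols)
matrices-rowBound [] cols with allZero cols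
... | true = z≤n ∷ []
... | false = []
matrices-rowBound (a ∷ as) cols =
  All-concatMap _ (rowsWith a cols) (All.map (λ {v} → extend v) (rowsWith-sound a cols))
  where
  extend : ∀ v → IsRow a cols v → All (λ Z → nonzeros (a ∷ as) ≤ nonzeros (concat Z)) (map (v ∷_) (matrices as (zipWith _∸_ cols v)))
  extend v (sv , le) = map⁺ (All.map (λ {Z} h → subst (nonzeros (a ∷ as) ≤_) (sym (nonzeros-++ v (concat Z))) (step a sv {Z} h))
                              (matrices-rowBound as (zipWith _∸_ cols v)))
    where
    step : ∀ a → sum v ≡ a → ∀ {Z} → nonzeros as ≤ nonzeros (concat Z) → nonzeros (a ∷ as) ≤ nonzeros v + nonzeros (concat Z)
    step zero _ h = ≤-trans h (m≤n+m _ (nonzeros v))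
    step (suc a) sv h = +-mono-≤ (nonzeros-sum v (subst (1 ≤_) (sym sv) (s≤s z≤n))) h

-- every non-zero column sum contributes a non-zero entry
matrices-colBound : (q cols : List ℕ) → All (λ Z → nonzeros cols ≤ nonzeros (concat Z)) (matrices q cols)
matrices-colBound [] cols with allZero cols in eq
... | true = ≤-reflexive (allZero⇒nonzeros≡0 cols eq) ∷ []
... | false = []
matrices-colBound (a ∷ as) cols =
  All-concatMap _ (rowsWith a cols) (All.map (λ {v} → extend v) (rowsWith-sound a cols))
  where
  extend : ∀ v → IsRow a cols v → All (λ Z → nonzeros cols ≤ nonzeros (concat Z)) (map (v ∷_) (matrices as (zipWith _∸_ cols v)))
  extend v (sv , le) = map⁺ (All.map (λ {Z} h → subst (nonzeros cols ≤_) (sym (nonzeros-++ v (concat Z)))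
      (≤-trans (nonzeros-split cols v le) (+-monoʳ-≤ (nonzeros v) h))) (matrices-colBound as (zipWith _∸_ cols v)))

Positive : List ℕ → Set
Positive = All (1 ≤_)

filter-isPos-id : (xs : List ℕ) → Positive xs → filterᵇ isPos xs ≡ xs
filter-isPos-id [] [] = refl
filter-isPos-id (suc x ∷ xs) (_ ∷ ps) = cong (suc x ∷_) (filter-isPos-id xs ps)

nonzeros-positive : (xs : List ℕ) → Positive xs → nonzeros xs ≡ length xs
nonzeros-positive [] [] = refl
nonzeros-positive (suc x ∷ xs) (_ ∷ ps) = cong suc (nonzeros-positive xs ps)

second-row-nonzero : ∀ {q₁ q₂ r₁ r₂ k} → 1 ≤ q₂ → q₁ + q₂ ≡ r₁ + r₂ → k ≤ q₁ → 1 ≤ (r₁ ∸ k) + (r₂ ∸ (q₁ ∸ k))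
second-row-nonzero {q₁} {q₂} {r₁} {r₂} {k} 1≤q₂ E k≤q₁ with r₁ ∸ k in e₁ | r₂ ∸ (q₁ ∸ k) in e₂
... | suc _ | _ = s≤s z≤n
... | zero | suc _ = s≤s z≤n
... | zero | zero = ⊥-elim (<⇒≱ (m<m+n q₁ 1≤q₂) (begin
       q₁ + q₂ ≡⟨ E ⟩
       r₁ + r₂ ≤⟨ +-mono-≤ (m∸n≡0⇒m≤n {r₁} {k} e₁) (m∸n≡0⇒m≤n {r₂} {q₁ ∸ k} e₂) ⟩
       k + (q₁ ∸ k) ≡⟨ m+[n∸m]≡n k≤q₁ ⟩
       q₁ ∎))
  where open ≤-Reasoning

-- The product formula.
module ProductFormula (n : ℕ) (n≥1 : 1 ≤ n) (ψ : List ℕ → ℕ)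
  (ψ-long : ∀ c → 3 ≤ length c → ψ c ≡ 0)
  (ψ-whole : ψ (n ∷ []) ≡ 1)
  (ψ-pairs : ∀ x y u v → 1 ≤ x → 1 ≤ y → 1 ≤ u → 1 ≤ v → x + y ≡ n → u + v ≡ n →
             ψ (x ∷ y ∷ []) * ψ (u ∷ v ∷ []) ≡ ψ (x ∷ y ∷ []) * (ind (x ≡ᵇ u) 1 + ind (x ≡ᵇ v) 1)) where

  ψc : List (List ℕ) → ℕ
  ψc Z = ψ (readComp Z)

  sumS : List ℕ → List ℕ → ℕ
  sumS q r = sum (map ψc (matrices q r))

  ψ-head2 : ∀ x y ws → 1 ≤ nonzeros ws → ψ (x ∷ y ∷ filterᵇ isPos ws) ≡ 0
  ψ-head2 x y ws h = ψ-long _ (s≤s (s≤s (subst (1 ≤_) (sym (length-filter-isPos ws)) h)))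

  nonzeros-pair : (x y : ℕ) → 1 ≤ x + y → 1 ≤ nonzeros (x ∷ y ∷ [])
  nonzeros-pair zero (suc y) _ = s≤s z≤n
  nonzeros-pair (suc x) y _ = s≤s z≤n

  -- a composition with ≥ 3 parts forces every Z to have ≥ 3 non-zero entries
  sumS-long : (q r : List ℕ) → 3 ≤ nonzeros q ⊎ 3 ≤ nonzeros r → sumS q r ≡ 0
  sumS-long q r (inj₁ h) = sum-map-zero _ (matrices q r)
    (All.map (λ {Z} hz → ψ-long _ (subst (3 ≤_) (sym (length-filter-isPos (concat Z))) (≤-trans h hz))) (matrices-rowBound q r))
  sumS-long q r (inj₂ h) = sum-map-zero _ (matrices q r)
    (All.map (λ {Z} hz → ψ-long _ (subst (3 ≤_) (sym (length-filter-isPos (concat Z))) (≤-trans h hz))) (matrices-colBound q r))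

  ψ-whole′ : ∀ m → m ≡ n → ψ (m ∷ []) ≡ 1
  ψ-whole′ m e = trans (cong (λ z → ψ (z ∷ [])) e) ψ-whole

  sum-pair : ∀ a b → a + (b + 0) ≡ a + b
  sum-pair a b = cong (a +_) (+-identityʳ b)

  -- q = [n]: S([n], r) = {r}
  product-whole : (q₁ : ℕ) (r : List ℕ) → Positive r → q₁ ≡ n → sum r ≡ n → sumS (q₁ ∷ []) r ≡ ψ (q₁ ∷ []) * ψ r
  product-whole q₁ r pr q₁n sr =
    begin
      sumS (q₁ ∷ []) r ≡⟨ sum-matrices-oneRow q₁ r ψc ⟩
      ind (sum r ≡ᵇ q₁) (ψc (r ∷ [])) ≡⟨ cong (λ z → ind z (ψc (r ∷ []))) (IsTrue⇒≡true (≡⇒≡ᵇ _ _ (trans sr (sym q₁n)))) ⟩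
      ψ (filterᵇ isPos (r ++ [])) ≡⟨ cong (λ z → ψ (filterᵇ isPos z)) (++-identityʳ r) ⟩
      ψ (filterᵇ isPos r) ≡⟨ cong ψ (filter-isPos-id r pr) ⟩
      ψ r ≡⟨ sym (*-identityˡ (ψ r)) ⟩
      1 * ψ r ≡⟨ cong (_* ψ r) (sym (ψ-whole′ q₁ q₁n)) ⟩
      ψ (q₁ ∷ []) * ψ r ∎
    where open ≡-Reasoning

  -- q = [q₁,q₂], r = [n]: S(q, [n]) = {the column q}
  product-pair-whole : (q₁ q₂ r₁ : ℕ) → Positive (q₁ ∷ q₂ ∷ []) → q₁ + q₂ ≡ n → r₁ ≡ n →
    sumS (q₁ ∷ q₂ ∷ []) (r₁ ∷ []) ≡ ψ (q₁ ∷ q₂ ∷ []) * ψ (r₁ ∷ [])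
  product-pair-whole q₁ q₂ r₁ pq sq r₁n =
    begin
      sumS (q₁ ∷ q₂ ∷ []) (r₁ ∷ []) ≡⟨ sum-matrices-twoRows q₁ q₂ (r₁ ∷ []) ψc (trans (+-identityʳ r₁) r₁q) ⟩
      sum (map G (rowsWith q₁ (r₁ ∷ []))) ≡⟨ sum-rowsWith-single q₁ r₁ G ⟩
      ind (q₁ <ᵇ suc (q₁ ⊓ r₁)) (G (q₁ ∷ [])) ≡⟨ cong (λ z → ind z (G (q₁ ∷ []))) (fits-true q₁ r₁ q₁≤r₁) ⟩
      ψ (filterᵇ isPos (q₁ ∷ r₁ ∸ q₁ ∷ [])) ≡⟨ cong (λ z → ψ (filterᵇ isPos (q₁ ∷ z ∷ []))) r₁∸q₁ ⟩
      ψ (filterᵇ isPos (q₁ ∷ q₂ ∷ [])) ≡⟨ cong ψ (filter-isPos-id _ pq) ⟩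
      ψ (q₁ ∷ q₂ ∷ []) ≡⟨ sym (*-identityʳ _) ⟩
      ψ (q₁ ∷ q₂ ∷ []) * 1 ≡⟨ cong (ψ (q₁ ∷ q₂ ∷ []) *_) (sym (ψ-whole′ r₁ r₁n)) ⟩
      ψ (q₁ ∷ q₂ ∷ []) * ψ (r₁ ∷ []) ∎
    where
    open ≡-Reasoning
    G : List ℕ → ℕ
    G v = ψc (v ∷ zipWith _∸_ (r₁ ∷ []) v ∷ [])
    r₁q : r₁ ≡ q₁ + q₂
    r₁q = trans r₁n (sym sq)
    q₁≤r₁ : q₁ ≤ r₁
    q₁≤r₁ = subst (q₁ ≤_) (sym r₁q) (m≤m+n q₁ q₂)
    r₁∸q₁ : r₁ ∸ q₁ ≡ q₂
    r₁∸q₁ = trans (cong (_∸ q₁) r₁q) (m+n∸m≡n q₁ q₂)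

  -- The 2×2 matrices in S([q₁,q₂],[r₁,r₂]) are indexed by their corner
  -- entry k; c(Z) has at most two parts only for the permutation matrices
  -- k = 0 (when q₁ = r₂) and k = q₁ (when q₁ = r₁).
  corner-term : (q₁ q₂ r₁ r₂ : ℕ) → 1 ≤ q₁ → 1 ≤ q₂ → 1 ≤ r₁ → 1 ≤ r₂ → q₁ + q₂ ≡ r₁ + r₂ →
    ∀ k → k ≤ q₁ → k ≤ r₁ →
    ind ((q₁ ∸ k) <ᵇ suc ((q₁ ∸ k) ⊓ r₂)) (ψ (filterᵇ isPos (k ∷ q₁ ∸ k ∷ r₁ ∸ k ∷ r₂ ∸ (q₁ ∸ k) ∷ [])))
      ≡ ind (k ≡ᵇ 0) (ind (q₁ ≡ᵇ r₂) (ψ (q₁ ∷ q₂ ∷ []))) + ind (k ≡ᵇ q₁) (ind (q₁ ≡ᵇ r₁) (ψ (q₁ ∷ q₂ ∷ [])))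
  corner-term (suc a) q₂ (suc b) r₂ _ _ _ _ E zero _ _ with <-cmp (suc a) r₂
  ... | tri< lt _ _ rewrite fits-true (suc a) r₂ (<⇒≤ lt) | ≡ᵇ-≢ {suc a} {r₂} (<⇒≢ lt)
        with r₂ ∸ suc a | m>n⇒m∸n≢0 lt
  ...   | zero | hh = ⊥-elim (hh refl)
  ...   | suc w | _ = ψ-head2 (suc a) (suc b) (suc w ∷ []) (s≤s z≤n)
  corner-term (suc a) q₂ (suc b) r₂ _ _ _ _ E zero _ _ | tri≈ _ refl _
        rewrite fits-true (suc a) (suc a) ≤-refl | n∸n≡0 (suc a) | ≡ᵇ-refl a =
        trans (cong (λ z → ψ (suc a ∷ z ∷ [])) (sym (+-cancelˡ-≡ (suc a) _ _ (trans E (+-comm (suc b) (suc a))))))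
              (sym (+-identityʳ _))
  corner-term (suc a) q₂ (suc b) r₂ _ _ _ _ E zero _ _ | tri> _ _ gt
        rewrite fits-false (suc a) r₂ gt | ≡ᵇ-≢ {suc a} {r₂} (>⇒≢ gt) = refl
  corner-term (suc a) q₂ r₁ (suc c) _ h₂ _ _ E (suc k) k≤q₁ k≤r₁ with suc k ≟ suc a
  ... | yes refl rewrite n∸n≡0 (suc k) | ≡ᵇ-refl k with r₁ ∸ suc k in eqr
  ...   | zero rewrite ≤-antisym (m∸n≡0⇒m≤n eqr) k≤r₁ | ≡ᵇ-refl k =
          cong (λ z → ψ (suc k ∷ z ∷ [])) (+-cancelˡ-≡ (suc k) _ _ (sym E))
  ...   | suc w rewrite ≡ᵇ-≢ {suc k} {r₁} (λ e → 0≢1+n (trans (sym (subst (λ z → z ∸ suc k ≡ 0) e (n∸n≡0 (suc k)))) eqr)) =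
          ψ-head2 (suc k) (suc w) (suc c ∷ []) (s≤s z≤n)
  corner-term (suc a) q₂ r₁ (suc c) _ h₂ _ _ E (suc k) k≤q₁ k≤r₁ | no ne
        rewrite ≡ᵇ-≢ ne with suc a ∸ suc k in eqq
  ... | zero = ⊥-elim (ne (≤-antisym k≤q₁ (m∸n≡0⇒m≤n eqq)))
  ... | suc e = trans (cong (ind (suc e <ᵇ suc (suc e ⊓ suc c)))
                  (ψ-head2 (suc k) (suc e) (r₁ ∸ suc k ∷ suc c ∸ suc e ∷ []) (nonzeros-pair (r₁ ∸ suc k) (suc c ∸ suc e)
                    (subst (λ z → 1 ≤ (r₁ ∸ suc k) + (suc c ∸ z)) eqq (second-row-nonzero h₂ E k≤q₁)))))
                  (ind-0 _)

  fits-corner : (q₁ r₁ X : ℕ) → ind (q₁ <ᵇ suc (q₁ ⊓ r₁)) (ind (q₁ ≡ᵇ r₁) X) ≡ ind (q₁ ≡ᵇ r₁) X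
  fits-corner q₁ r₁ X with q₁ ≟ r₁
  ... | yes refl rewrite fits-true q₁ q₁ ≤-refl = refl
  ... | no ne rewrite ≡ᵇ-≢ ne = ind-0 _

  product-pair-pair : (q₁ q₂ r₁ r₂ : ℕ) → Positive (q₁ ∷ q₂ ∷ []) → Positive (r₁ ∷ r₂ ∷ []) →
    q₁ + q₂ ≡ n → r₁ + r₂ ≡ n → sumS (q₁ ∷ q₂ ∷ []) (r₁ ∷ r₂ ∷ []) ≡ ψ (q₁ ∷ q₂ ∷ []) * ψ (r₁ ∷ r₂ ∷ [])
  product-pair-pair zero _ _ _ (() ∷ _) _ _ _
  product-pair-pair q₁@(suc _) q₂ r₁ r₂ (p₁ ∷ p₂ ∷ []) (t₁ ∷ t₂ ∷ []) sq sr =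
    begin
      sumS q r ≡⟨ sum-matrices-twoRows q₁ q₂ r ψc (trans (sum-pair r₁ r₂) (sym E)) ⟩
      sum (map G (rowsWith q₁ r)) ≡⟨ sum-map-concatMap G (λ k → map (k ∷_) (rowsWith (q₁ ∸ k) (r₂ ∷ []))) (upTo N) ⟩
      sum (map (λ k → sum (map G (map (k ∷_) (rowsWith (q₁ ∸ k) (r₂ ∷ []))))) (upTo N))
        ≡⟨ sum-map-cong (λ k → trans (sum-map-map G (k ∷_) (rowsWith (q₁ ∸ k) (r₂ ∷ [])))
                                     (sum-rowsWith-single (q₁ ∸ k) r₂ (λ v → G (k ∷ v)))) (upTo N) ⟩
      sum (map Tk (upTo N)) ≡⟨ sum-upTo Tk N ⟩
      sumBelow Tk N
        ≡⟨ sumBelow-cong N (λ k k<N → corner-term q₁ q₂ r₁ r₂ p₁ p₂ t₁ t₂ E k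
                                         (≤-trans (≤-pred k<N) (m⊓n≤m q₁ r₁)) (≤-trans (≤-pred k<N) (m⊓n≤n q₁ r₁))) ⟩
      sumBelow (λ k → ind (k ≡ᵇ 0) A₀ + ind (k ≡ᵇ q₁) A₁) N ≡⟨ sumBelow-+ (λ k → ind (k ≡ᵇ 0) A₀) (λ k → ind (k ≡ᵇ q₁) A₁) N ⟩
      sumBelow (λ k → ind (k ≡ᵇ 0) A₀) N + sumBelow (λ k → ind (k ≡ᵇ q₁) A₁) N
        ≡⟨ cong₂ _+_ (sumBelow-point 0 A₀ N) (sumBelow-point q₁ A₁ N) ⟩
      A₀ + ind (q₁ <ᵇ N) A₁ ≡⟨ cong (A₀ +_) (fits-corner q₁ r₁ ψq) ⟩
      A₀ + A₁ ≡⟨ +-comm A₀ A₁ ⟩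
      A₁ + A₀ ≡⟨ sym (cong₂ _+_ (ind-* (q₁ ≡ᵇ r₁) ψq) (ind-* (q₁ ≡ᵇ r₂) ψq)) ⟩
      ψq * ind (q₁ ≡ᵇ r₁) 1 + ψq * ind (q₁ ≡ᵇ r₂) 1 ≡⟨ sym (*-distribˡ-+ ψq _ _) ⟩
      ψq * (ind (q₁ ≡ᵇ r₁) 1 + ind (q₁ ≡ᵇ r₂) 1) ≡⟨ sym (ψ-pairs q₁ q₂ r₁ r₂ p₁ p₂ t₁ t₂ sq sr) ⟩
      ψq * ψ r ∎
    where
    open ≡-Reasoning
    q = q₁ ∷ q₂ ∷ []
    r = r₁ ∷ r₂ ∷ []
    ψq = ψ q
    N = suc (q₁ ⊓ r₁)
    E : q₁ + q₂ ≡ r₁ + r₂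
    E = trans sq (sym sr)
    G : List ℕ → ℕ
    G v = ψc (v ∷ zipWith _∸_ r v ∷ [])
    Tk : ℕ → ℕ
    Tk k = ind ((q₁ ∸ k) <ᵇ suc ((q₁ ∸ k) ⊓ r₂)) (G (k ∷ q₁ ∸ k ∷ []))
    A₀ = ind (q₁ ≡ᵇ r₂) ψq
    A₁ = ind (q₁ ≡ᵇ r₁) ψq

  three : (r : List ℕ) → 3 ≤ 3 + length r
  three _ = s≤s (s≤s (s≤s z≤n))

  product-formula : (q r : List ℕ) → Positive q → Positive r → sum q ≡ n → sum r ≡ n → sumS q r ≡ ψ q * ψ r
  product-formula [] _ _ _ sq _ = ⊥-elim (<⇒≢ n≥1 sq)
  product-formula (_ ∷ _) [] _ _ _ sr = ⊥-elim (<⇒≢ n≥1 sr)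
  product-formula (q₁ ∷ []) r _ pr sq sr = product-whole q₁ r pr (trans (sym (+-identityʳ q₁)) sq) sr
  product-formula (q₁ ∷ q₂ ∷ []) (r₁ ∷ []) pq _ sq sr =
    product-pair-whole q₁ q₂ r₁ pq (trans (sym (sum-pair q₁ q₂)) sq) (trans (sym (+-identityʳ r₁)) sr)
  product-formula (q₁ ∷ q₂ ∷ []) (r₁ ∷ r₂ ∷ []) pq pr sq sr =
    product-pair-pair q₁ q₂ r₁ r₂ pq pr (trans (sym (sum-pair q₁ q₂)) sq) (trans (sym (sum-pair r₁ r₂)) sr)
  product-formula (q₁ ∷ q₂ ∷ []) r@(_ ∷ _ ∷ _ ∷ rs) pq pr sq sr =
    trans (sumS-long (q₁ ∷ q₂ ∷ []) r (inj₂ (subst (3 ≤_) (sym (nonzeros-positive r pr)) (three rs))))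
      (sym (trans (cong (ψ (q₁ ∷ q₂ ∷ []) *_) (ψ-long r (three rs))) (*-zeroʳ (ψ (q₁ ∷ q₂ ∷ [])))))
  product-formula q@(_ ∷ _ ∷ _ ∷ qs) r pq pr sq sr =
    trans (sumS-long q r (inj₁ (subst (3 ≤_) (sym (nonzeros-positive q pq)) (three qs))))
      (sym (cong (_* ψ r) (ψ-long q (three qs))))

module Weights (n : ℕ) where

  w₀ : List ℕ → ℕ
  w₀ c = indL c (n ∷ [])

  w₀-long : ∀ c → 3 ≤ length c → w₀ c ≡ 0
  w₀-long c h = indL-long c _ h (s≤s (s≤s z≤n))

  w₀-whole : w₀ (n ∷ []) ≡ 1
  w₀-whole = indL-yes (n ∷ [])

  w₀-pairs : ∀ x y u v → 1 ≤ x → 1 ≤ y → 1 ≤ u → 1 ≤ v → x + y ≡ n → u + v ≡ n →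
    w₀ (x ∷ y ∷ []) * w₀ (u ∷ v ∷ []) ≡ w₀ (x ∷ y ∷ []) * (ind (x ≡ᵇ u) 1 + ind (x ≡ᵇ v) 1)
  w₀-pairs x y u v _ _ _ _ _ _ rewrite indL-no (x ∷ y ∷ []) (n ∷ []) (λ ()) = refl

  module _ (a : ℕ) where
    private
      b : ℕ
      b = n ∸ a

    wPair : List ℕ → ℕ
    wPair c = indL c (n ∷ []) + (indL c (a ∷ b ∷ []) + indL c (b ∷ a ∷ []))

    wPair-long : ∀ c → 3 ≤ length c → wPair c ≡ 0
    wPair-long c h rewrite indL-long c (n ∷ []) h (s≤s (s≤s z≤n)) | indL-long c (a ∷ b ∷ []) h (s≤s (s≤s (s≤s z≤n)))
      | indL-long c (b ∷ a ∷ []) h (s≤s (s≤s (s≤s z≤n))) = refl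

    wPair-whole : wPair (n ∷ []) ≡ 1
    wPair-whole rewrite indL-yes (n ∷ []) | indL-no (n ∷ []) (a ∷ b ∷ []) (λ ()) | indL-no (n ∷ []) (b ∷ a ∷ []) (λ ()) = refl

    module _ (a≤n : a ≤ n) where
      private
        ab : a + b ≡ n
        ab = m+[n∸m]≡n a≤n
        ba : b + a ≡ n
        ba = trans (+-comm b a) ab

      firstPart : ℕ → ℕ
      firstPart x = ind (x ≡ᵇ a) 1 + ind (x ≡ᵇ b) 1

      wPair-on-pair : ∀ x y → x + y ≡ n → wPair (x ∷ y ∷ []) ≡ firstPart x
      wPair-on-pair x y e rewrite indL-no (x ∷ y ∷ []) (n ∷ []) (λ ()) | indL-pair x y a b (trans e (sym ab))
        | indL-pair x y b a (trans e (sym ba)) = refl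

      firstPart-swap : ∀ x u v → u + v ≡ n → (x ≡ a ⊎ x ≡ b) → ind (x ≡ᵇ u) 1 + ind (x ≡ᵇ v) 1 ≡ firstPart u
      firstPart-swap x u v e (inj₁ refl) = cong₂ _+_ (cong (λ z → ind z 1) (≡ᵇ-sym x u))
         (cong (λ z → ind z 1) (Bool-ext
           (λ h → IsTrue⇒≡true (≡⇒≡ᵇ _ _ (+-cancelʳ-≡ a u b (trans (cong (u +_) (≡ᵇ-sound h)) (trans e (sym ba))))))
           (λ h → IsTrue⇒≡true (≡⇒≡ᵇ _ _ (+-cancelʳ-≡ u a v (trans (cong (a +_) (≡ᵇ-sound h)) (trans ab (trans (sym e) (+-comm u v)))))))))
      firstPart-swap x u v e (inj₂ refl) = trans (+-comm (ind (b ≡ᵇ u) 1) (ind (b ≡ᵇ v) 1)) (cong₂ _+_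
         (cong (λ z → ind z 1) (Bool-ext
           (λ h → IsTrue⇒≡true (≡⇒≡ᵇ _ _ (+-cancelʳ-≡ b u a (trans (cong (u +_) (≡ᵇ-sound h)) (trans e (sym ab))))))
           (λ h → IsTrue⇒≡true (≡⇒≡ᵇ _ _ (+-cancelʳ-≡ u b v (trans (cong (b +_) (≡ᵇ-sound h)) (trans ba (trans (sym e) (+-comm u v)))))))))
         (cong (λ z → ind z 1) (≡ᵇ-sym x u)))

      wPair-pairs : ∀ x y u v → 1 ≤ x → 1 ≤ y → 1 ≤ u → 1 ≤ v → x + y ≡ n → u + v ≡ n →
        wPair (x ∷ y ∷ []) * wPair (u ∷ v ∷ []) ≡ wPair (x ∷ y ∷ []) * (ind (x ≡ᵇ u) 1 + ind (x ≡ᵇ v) 1)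
      wPair-pairs x y u v _ _ _ _ e₁ e₂ rewrite wPair-on-pair x y e₁ | wPair-on-pair u v e₂ with x ≟ a | x ≟ b
      ... | yes xa | _ = cong (firstPart x *_) (sym (firstPart-swap x u v e₂ (inj₁ xa)))
      ... | no _ | yes xb = cong (firstPart x *_) (sym (firstPart-swap x u v e₂ (inj₂ xb)))
      ... | no na | no nb rewrite ≡ᵇ-≢ na | ≡ᵇ-≢ nb = refl

comps-sound : ∀ f m → All (λ c → Positive c × sum c ≡ m) (compsF f m)
comps-sound _ zero = ([] , refl) ∷ []
comps-sound zero (suc m) = []
comps-sound (suc f) (suc m) = All-concatMap _ (upTo (suc m)) (All.map (λ {k} → extend k) (all-upTo (suc m)))
  where
  extend : ∀ k → k < suc m → All (λ c → Positive c × sum c ≡ suc m) (map (suc k ∷_) (compsF f (m ∸ k)))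
  extend k (s≤s k≤m) = map⁺ (All.map (λ (pc , sc) → (s≤s z≤n ∷ pc) , cong suc (trans (cong (k +_) sc) (m+[n∸m]≡n k≤m)))
                                      (comps-sound f (m ∸ k)))

count-++ : (c : List ℕ) (xs ys : List (List ℕ)) → count c (xs ++ ys) ≡ count c xs + count c ys
count-++ c [] ys = refl
count-++ c (x ∷ xs) ys = trans (cong ((if eqL c x then 1 else 0) +_) (count-++ c xs ys))
                               (sym (+-assoc (if eqL c x then 1 else 0) (count c xs) (count c ys)))

count-concatMap : (c : List ℕ) (g : A → List (List ℕ)) (xs : List A) →
  count c (concatMap g xs) ≡ sum (map (λ x → count c (g x)) xs)
count-concatMap c g [] = refl
count-concatMap c g (x ∷ xs) = trans (count-++ c (g x) (concatMap g xs)) (cong (count c (g x) +_) (count-concatMap c g xs))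

count-map-cons : (x y : ℕ) (t : List ℕ) (Ls : List (List ℕ)) → count (x ∷ t) (map (y ∷_) Ls) ≡ ind (x ≡ᵇ y) (count t Ls)
count-map-cons x y t [] = sym (ind-0 _)
count-map-cons x y t (l ∷ Ls) rewrite count-map-cons x y t Ls with x ≡ᵇ y
... | true = refl
... | false = refl

-- a composition of m has at most m parts (fuel n suffices for comps n)
length≤sum : (c : List ℕ) → Positive c → length c ≤ sum c
length≤sum [] [] = z≤n
length≤sum (x ∷ c) (h ∷ ps) = +-mono-≤ h (length≤sum c ps)

count-compsF : ∀ f m (c : List ℕ) → Positive c → sum c ≡ m → length c ≤ f → count c (compsF f m) ≡ 1
count-compsF f zero [] _ _ _ = refl
count-compsF f zero (suc x ∷ c) _ () _
count-compsF f zero (zero ∷ c) (() ∷ _) _ _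
count-compsF zero (suc m) [] _ () _
count-compsF zero (suc m) (x ∷ c) _ _ ()
count-compsF (suc f) (suc m) [] _ () _
count-compsF (suc f) (suc m) (suc h ∷ t) (_ ∷ pt) sc (s≤s lt) =
  begin
    count (suc h ∷ t) (compsF (suc f) (suc m))
      ≡⟨ count-concatMap _ (λ k → map (suc k ∷_) (compsF f (m ∸ k))) (upTo (suc m)) ⟩
    sum (map (λ k → count (suc h ∷ t) (map (suc k ∷_) (compsF f (m ∸ k)))) (upTo (suc m)))
      ≡⟨ sum-map-cong (λ k → trans (count-map-cons (suc h) (suc k) t (compsF f (m ∸ k)))
                                   (cong (λ z → ind z (count t (compsF f (m ∸ k)))) (≡ᵇ-sym h k))) (upTo (suc m)) ⟩
    sum (map (λ k → ind (k ≡ᵇ h) (count t (compsF f (m ∸ k)))) (upTo (suc m))) ≡⟨ sum-upTo _ (suc m) ⟩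
    sumBelow (λ k → ind (k ≡ᵇ h) (count t (compsF f (m ∸ k)))) (suc m) ≡⟨ sumBelow-cong (suc m) (λ k _ → at-h k) ⟩
    sumBelow (λ k → ind (k ≡ᵇ h) (count t (compsF f (m ∸ h)))) (suc m) ≡⟨ sumBelow-point h _ (suc m) ⟩
    ind (h <ᵇ suc m) (count t (compsF f (m ∸ h))) ≡⟨ cong (λ z → ind z (count t (compsF f (m ∸ h)))) (<ᵇ-complete (s≤s h≤m)) ⟩
    count t (compsF f (m ∸ h)) ≡⟨ count-compsF f (m ∸ h) t pt st lt ⟩
    1 ∎
  where
  open ≡-Reasoning
  sm : h + sum t ≡ m
  sm = suc-injective sc
  h≤m : h ≤ m
  h≤m = subst (h ≤_) sm (m≤m+n h (sum t))
  st : sum t ≡ m ∸ h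
  st = trans (sym (m+n∸m≡n h (sum t))) (cong (_∸ h) sm)
  at-h : ∀ k → ind (k ≡ᵇ h) (count t (compsF f (m ∸ k))) ≡ ind (k ≡ᵇ h) (count t (compsF f (m ∸ h)))
  at-h k with k ≟ h
  ... | yes refl = refl
  ... | no ne rewrite ≡ᵇ-≢ ne = refl

count≥1⇒∈ : (c : List ℕ) (Ls : List (List ℕ)) → 1 ≤ count c Ls → c ∈ Ls
count≥1⇒∈ c (l ∷ Ls) h with ≡-dec _≟_ c l
... | yes refl = here refl
... | no ne = there (count≥1⇒∈ c Ls h)

count-self : (Ls : List (List ℕ)) (i : Fin (length Ls)) → 1 ≤ count (L.lookup Ls i) Ls
count-self (e ∷ Ls) F.zero rewrite dec-true (≡-dec _≟_ e e) refl = s≤s z≤n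
count-self (e ∷ Ls) (F.suc i) = ≤-trans (count-self Ls i) (m≤n+m _ _)

lookup-injective : (Ls : List (List ℕ)) → (∀ i → count (L.lookup Ls i) Ls ≤ 1) →
  ∀ k j → L.lookup Ls k ≡ L.lookup Ls j → k ≡ j
lookup-injective (e ∷ Ls) h F.zero F.zero eq = refl
lookup-injective (e ∷ Ls) h F.zero (F.suc j) eq with h (F.suc j)
... | hj rewrite dec-true (≡-dec _≟_ (L.lookup Ls j) e) (sym eq) = ⊥-elim (<⇒≱ (s≤s (count-self Ls j)) hj)
lookup-injective (e ∷ Ls) h (F.suc k) F.zero eq with h (F.suc k)
... | hk rewrite dec-true (≡-dec _≟_ (L.lookup Ls k) e) eq = ⊥-elim (<⇒≱ (s≤s (count-self Ls k)) hk)
lookup-injective (e ∷ Ls) h (F.suc k) (F.suc j) eq =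
  cong F.suc (lookup-injective Ls (λ i → ≤-trans (m≤n+m _ _) (h (F.suc i))) k j eq)

-- Arithmetic in F_p, represented by naturals up to congruence mod p.
module ModArith (p : ℕ) {{_ : NonZero p}} (pp : Prime p) where

  p>1 : 1 < p
  p>1 = nonTrivial⇒n>1 p {{prime⇒nonTrivial pp}}

  infix 4 _≡ₚ_
  _≡ₚ_ : ℕ → ℕ → Set
  a ≡ₚ b = a % p ≡ b % p

  ≡ₚ-+ : ∀ {a a' b b'} → a ≡ₚ a' → b ≡ₚ b' → a + b ≡ₚ a' + b'
  ≡ₚ-+ {a} {a'} {b} {b'} e₁ e₂ =
    trans (%-distribˡ-+ a b p) (trans (cong₂ (λ x y → (x + y) % p) e₁ e₂) (sym (%-distribˡ-+ a' b' p)))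

  ≡ₚ-* : ∀ {a a' b b'} → a ≡ₚ a' → b ≡ₚ b' → a * b ≡ₚ a' * b'
  ≡ₚ-* {a} {a'} {b} {b'} e₁ e₂ =
    trans (%-distribˡ-* a b p) (trans (cong₂ (λ x y → (x * y) % p) e₁ e₂) (sym (%-distribˡ-* a' b' p)))

  sum-≡ₚ : (f g : A → ℕ) (xs : List A) → (∀ x → f x ≡ₚ g x) → sum (map f xs) ≡ₚ sum (map g xs)
  sum-≡ₚ f g [] h = refl
  sum-≡ₚ f g (x ∷ xs) h = ≡ₚ-+ (h x) (sum-≡ₚ f g xs h)

  1%p : 1 % p ≡ 1
  1%p = m<n⇒m%n≡m p>1

  0%p : 0 % p ≡ 0
  0%p = m<n⇒m%n≡m (<-trans (s≤s z≤n) p>1)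

  +p : ∀ t → t + p ≡ₚ t
  +p t = trans (cong (λ z → (t + z) % p) (sym (+-identityʳ p))) ([m+kn]%n≡m%n t 1 p)

  toℕ-mod : ∀ m → toℕ (m mod p) ≡ m % p
  toℕ-mod m = FP.toℕ-fromℕ< _

  toℕ-mod-≡ₚ : ∀ m → toℕ (m mod p) ≡ₚ m
  toℕ-mod-≡ₚ m = trans (cong (_% p) (toℕ-mod m)) (m%n%n≡m%n m p)

  mod-≡ₚ : ∀ {m m'} → m ≡ₚ m' → m mod p ≡ m' mod p
  mod-≡ₚ {m} {m'} e = FP.toℕ-injective (trans (toℕ-mod m) (trans e (sym (toℕ-mod m'))))

  mod-toℕ : ∀ (a : Fin p) → toℕ a mod p ≡ a
  mod-toℕ a = FP.toℕ-injective (trans (toℕ-mod _) (m<n⇒m%n≡m (FP.toℕ<n a)))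

  -- Additive inverses: p - 1 plays the role of -1.

  1+t≡1⇒t≡0 : ∀ t → 1 + t ≡ₚ 1 → t ≡ₚ 0
  1+t≡1⇒t≡0 t e = begin
      t % p ≡⟨ sym (+p t) ⟩
      (t + p) % p ≡⟨ cong (_% p) (trans (cong (t +_) (sym (m+[n∸m]≡n (<⇒≤ p>1)))) (+-suc t (p ∸ 1))) ⟩
      ((1 + t) + (p ∸ 1)) % p ≡⟨ ≡ₚ-+ {1 + t} {1} {p ∸ 1} {p ∸ 1} e refl ⟩
      (1 + (p ∸ 1)) % p ≡⟨ cong (_% p) (m+[n∸m]≡n (<⇒≤ p>1)) ⟩
      p % p ≡⟨ n%n≡0 p ⟩
      0 ≡⟨ sym 0%p ⟩
      0 % p ∎
    where open ≡-Reasoning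

  a+b≡0⇒a≡-b : ∀ a b → a + b ≡ₚ 0 → a ≡ₚ (p ∸ 1) * b
  a+b≡0⇒a≡-b a b e = begin
      a % p ≡⟨ sym ([m+kn]%n≡m%n a b p) ⟩
      (a + b * p) % p ≡⟨ cong (_% p) rearrange ⟩
      ((p ∸ 1) * b + (a + b)) % p ≡⟨ ≡ₚ-+ {(p ∸ 1) * b} refl e ⟩
      ((p ∸ 1) * b + 0) % p ≡⟨ cong (_% p) (+-identityʳ _) ⟩
      ((p ∸ 1) * b) % p ∎
    where
    open ≡-Reasoning
    rearrange : a + b * p ≡ (p ∸ 1) * b + (a + b)
    rearrange = begin
      a + b * p ≡⟨ cong (λ z → a + b * z) (sym (m+[n∸m]≡n (<⇒≤ p>1))) ⟩
      a + b * (1 + (p ∸ 1)) ≡⟨ cong (a +_) (trans (*-distribˡ-+ b 1 (p ∸ 1)) (cong₂ _+_ (*-identityʳ b) (*-comm b (p ∸ 1)))) ⟩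
      a + (b + (p ∸ 1) * b) ≡⟨ sym (+-assoc a b _) ⟩
      (a + b) + (p ∸ 1) * b ≡⟨ +-comm (a + b) _ ⟩
      (p ∸ 1) * b + (a + b) ∎

  -- F_p is a field: every c ≢ 0 mod p has an inverse (Bézout, as p is prime).
  inverse : ∀ c → c % p ≢ 0 → Σ ℕ (λ u → u * c ≡ₚ 1)
  inverse c c≢0 with coprime-Bézout (prime⇒coprime pp {{≢-nonZero c≢0}} (m%n<n c p))
  ... | Bézout.-+ x y eq = y , (begin
      (y * c) % p ≡⟨ ≡ₚ-* {y} refl (sym (m%n%n≡m%n c p)) ⟩
      (y * (c % p)) % p ≡⟨ cong (_% p) (sym eq) ⟩
      (1 + x * p) % p ≡⟨ [m+kn]%n≡m%n 1 x p ⟩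
      1 % p ∎)
    where open ≡-Reasoning
  ... | Bézout.+- x y eq = (p ∸ 1) * y , (begin
      ((p ∸ 1) * y * c) % p ≡⟨ cong (_% p) (*-assoc (p ∸ 1) y c) ⟩
      ((p ∸ 1) * (y * c)) % p ≡⟨ ≡ₚ-* {p ∸ 1} refl (≡ₚ-* {y} refl (sym (m%n%n≡m%n c p))) ⟩
      ((p ∸ 1) * (y * (c % p))) % p ≡⟨ sym (a+b≡0⇒a≡-b 1 (y * (c % p)) one-plus) ⟩
      1 % p ∎)
    where
    open ≡-Reasoning
    one-plus : 1 + y * (c % p) ≡ₚ 0
    one-plus = trans (cong (_% p) eq) (trans (m*n%n≡0 x p) (sym 0%p))

-- The linear functional χ_w(x) = Σ_q w(q) x_q on Σ(n,p), computed in ℕ and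
-- read mod p.  It is multiplicative when w satisfies the product formula.
module Functional (n p : ℕ) (pp : Prime p) (n≥1 : 1 ≤ n) where
  open Sigma n p pp
  open ModArith p pp public

  toℕ-fp0 : toℕ (fp 0) ≡ 0
  toℕ-fp0 = trans (toℕ-mod 0) 0%p

  toℕ-fp1 : toℕ (fp 1) ≡ 1
  toℕ-fp1 = trans (toℕ-mod 1) 1%p

  Elem-ext : {u v : Elem} → (∀ i → V.lookup u i ≡ V.lookup v i) → u ≡ v
  Elem-ext {u} {v} h = trans (sym (VP.tabulate∘lookup u)) (trans (VP.tabulate-cong h) (VP.tabulate∘lookup v))

  Elem-ext-≡ₚ : {u v : Elem} → (∀ i → toℕ (V.lookup u i) ≡ₚ toℕ (V.lookup v i)) → u ≡ v
  Elem-ext-≡ₚ {u} {v} h = Elem-ext λ i →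
    trans (sym (mod-toℕ (V.lookup u i))) (trans (mod-≡ₚ (h i)) (mod-toℕ (V.lookup v i)))

  toℕ-+ₑ : ∀ a b j → toℕ (V.lookup (a +ₑ b) j) ≡ₚ toℕ (V.lookup a j) + toℕ (V.lookup b j)
  toℕ-+ₑ a b j = trans (cong (λ z → toℕ z % p) (VP.lookup-zipWith _ j a b)) (toℕ-mod-≡ₚ _)

  y+[v-y]≡v : ∀ (y v : Elem) → y +ₑ (v -ₑ y) ≡ v
  y+[v-y]≡v y v = Elem-ext-≡ₚ λ i → trans (toℕ-+ₑ y (v -ₑ y) i)
      (trans (cong (λ z → (toℕ (V.lookup y i) + toℕ z) % p) (VP.lookup-zipWith _ i v y))
        (cancel (toℕ (V.lookup y i)) (toℕ (V.lookup v i)) (FP.toℕ≤pred[n] (V.lookup y i))))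
    where
    cancel : ∀ Y W → Y ≤ pred p → Y + toℕ (fp (W + (p ∸ Y))) ≡ₚ W
    cancel Y W Y≤ = begin
      (Y + toℕ (fp (W + (p ∸ Y)))) % p ≡⟨ ≡ₚ-+ {Y} {Y} refl (toℕ-mod-≡ₚ (W + (p ∸ Y))) ⟩
      (Y + (W + (p ∸ Y))) % p ≡⟨ cong (_% p) (trans (sym (+-assoc Y W _)) (trans (cong (_+ (p ∸ Y)) (+-comm Y W)) (+-assoc W Y _))) ⟩
      (W + (Y + (p ∸ Y))) % p ≡⟨ cong (λ z → (W + z) % p) (m+[n∸m]≡n (≤-trans Y≤ pred[n]≤n)) ⟩
      (W + p) % p ≡⟨ +p W ⟩
      W % p ∎
      where open ≡-Reasoning

  compAt-composition : ∀ i → Positive (compAt i) × sum (compAt i) ≡ n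
  compAt-composition i = All.lookup (comps-sound n n) (∈-lookup {xs = comps n} i)

  count-comps : ∀ c → Positive c → sum c ≡ n → count c (comps n) ≡ 1
  count-comps c pc sc = count-compsF n n c pc sc (subst (length c ≤_) sc (length≤sum c pc))

  count-compAt : ∀ j → count (compAt j) (comps n) ≡ 1
  count-compAt j = count-comps (compAt j) (proj₁ (compAt-composition j)) (proj₂ (compAt-composition j))

  toℕ-B : ∀ q k → toℕ (V.lookup (B q) k) ≡ indL (compAt k) q
  toℕ-B q k rewrite VP.lookup∘tabulate (λ j → if does (≡-dec _≟_ (compAt j) q) then fp 1 else fp 0) k
    with does (≡-dec _≟_ (compAt k) q)
  ... | true = toℕ-fp1
  ... | false = toℕ-fp0

  χ : (List ℕ → ℕ) → Elem → ℕ
  χ w x = sum (map (λ k → w (compAt k) * toℕ (V.lookup x k)) (allFin d))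

  module _ (w : List ℕ → ℕ) where
    χ-0 : χ w 0# ≡ 0
    χ-0 = sum-map-zero _ (allFin d) (All.universal (λ k →
       trans (cong (λ z → w (compAt k) * toℕ z) (VP.lookup-replicate k (fp 0)))
         (trans (cong (w (compAt k) *_) toℕ-fp0) (*-zeroʳ (w (compAt k))))) (allFin d))

    χ-+ : ∀ x y → χ w (x +ₑ y) ≡ₚ χ w x + χ w y
    χ-+ x y = trans (sum-≡ₚ _ (λ k → w (compAt k) * toℕ (V.lookup x k) + w (compAt k) * toℕ (V.lookup y k)) (allFin d) (λ k →
        trans (≡ₚ-* {w (compAt k)} refl (toℕ-+ₑ x y k)) (cong (_% p) (*-distribˡ-+ (w (compAt k)) _ _))))
        (cong (_% p) (sum-map-+ _ _ (allFin d)))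

    χ-· : ∀ c x → χ w (c ·ₑ x) ≡ₚ toℕ c * χ w x
    χ-· c x = trans (sum-≡ₚ _ (λ k → toℕ c * (w (compAt k) * toℕ (V.lookup x k))) (allFin d) (λ k →
        trans (cong (λ z → (w (compAt k) * toℕ z) % p) (VP.lookup-map k _ x))
          (trans (≡ₚ-* {w (compAt k)} refl (toℕ-mod-≡ₚ _)) (cong (_% p) (x*[y*z]≡y*[x*z] (w (compAt k)) (toℕ c) _)))))
        (cong (_% p) (sym (sum-map-*ˡ (toℕ c) _ (allFin d))))
      where
      x*[y*z]≡y*[x*z] : ∀ a b c → a * (b * c) ≡ b * (a * c)
      x*[y*z]≡y*[x*z] a b c = trans (sym (*-assoc a b c)) (trans (cong (_* c) (*-comm a b)) (*-assoc b a c))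

    χ-B : ∀ q → χ w (B q) ≡ w q * count q (comps n)
    χ-B q = trans (sum-map-cong (λ k → cong (w (compAt k) *_) (toℕ-B q k)) (allFin d))
       (trans (sum-allFin (λ e → w e * indL e q) (comps n)) (sum-indL w q (comps n)))

    -- Multiplicativity, from the product formula on basis elements and
    -- bilinearity of the structure constants in Defs._*ₑ_.
    module Multiplicative (w-supp : ∀ c → w c * count c (comps n) ≡ w c)
                          (w-product : ∀ q r → Positive q → Positive r → sum q ≡ n → sum r ≡ n →
                                       sum (map (λ Z → w (readComp Z)) (matrices q r)) ≡ w q * w r) where

      products : Fin d → Fin d → List (List ℕ)
      products i j = map readComp (matrices (compAt i) (compAt j))

      χ-basis-product : ∀ i j → sum (map (λ k → w (compAt k) * count (compAt k) (products i j)) (allFin d)) ≡ w (compAt i) * w (compAt j)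
      χ-basis-product i j =
        begin
          _ ≡⟨ sum-allFin (λ e → w e * count e Ps) (comps n) ⟩
          sum (map (λ e → w e * count e Ps) (comps n))
            ≡⟨ sum-map-cong (λ e → trans (cong (w e *_) (count-as-sum e Ps)) (sum-map-*ˡ (w e) (indL e) Ps)) (comps n) ⟩
          sum (map (λ e → sum (map (λ c → w e * indL e c) Ps)) (comps n)) ≡⟨ sum-swap (λ e c → w e * indL e c) (comps n) Ps ⟩
          sum (map (λ c → sum (map (λ e → w e * indL e c) (comps n))) Ps)
            ≡⟨ sum-map-cong (λ c → trans (sum-indL w c (comps n)) (w-supp c)) Ps ⟩
          sum (map w Ps) ≡⟨ sum-map-map w readComp (matrices (compAt i) (compAt j)) ⟩
          sum (map (λ Z → w (readComp Z)) (matrices (compAt i) (compAt j)))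
            ≡⟨ w-product (compAt i) (compAt j) (proj₁ (compAt-composition i)) (proj₁ (compAt-composition j))
                         (proj₂ (compAt-composition i)) (proj₂ (compAt-composition j)) ⟩
          w (compAt i) * w (compAt j) ∎
        where
        open ≡-Reasoning
        Ps = products i j

      open +-*-Solver

      χ-scaled-basis-product : ∀ α β i j →
        sum (map (λ k → w (compAt k) * (α * β * count (compAt k) (products i j))) (allFin d)) ≡ (w (compAt i) * α) * (w (compAt j) * β)
      χ-scaled-basis-product α β i j = begin
          sum (map (λ k → wk k * (α * β * count (compAt k) (products i j))) fd)
            ≡⟨ sum-map-cong (λ k → solve 3 (λ w' t c → w' :* (t :* c) := t :* (w' :* c)) refl
                                            (wk k) (α * β) (count (compAt k) (products i j))) fd ⟩
          sum (map (λ k → (α * β) * (wk k * count (compAt k) (products i j))) fd)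
            ≡⟨ sym (sum-map-*ˡ (α * β) _ fd) ⟩
          (α * β) * sum (map (λ k → wk k * count (compAt k) (products i j)) fd)
            ≡⟨ cong ((α * β) *_) (χ-basis-product i j) ⟩
          (α * β) * (wk i * wk j)
            ≡⟨ solve 4 (λ a b c e → (a :* b) :* (c :* e) := (c :* a) :* (e :* b)) refl α β (wk i) (wk j) ⟩
          (wk i * α) * (wk j * β) ∎
        where
        open ≡-Reasoning
        fd = allFin d
        wk : Fin d → ℕ
        wk k = w (compAt k)

      χ-* : ∀ a x → χ w (a *ₑ x) ≡ₚ χ w a * χ w x
      χ-* a x = trans (sum-≡ₚ _ (λ k → wk k * S k) fd (λ k →
           trans (cong (λ z → (wk k * toℕ z) % p) (VP.lookup∘tabulate (λ k → fp (S k)) k))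
             (≡ₚ-* {wk k} refl (toℕ-mod-≡ₚ (S k))))) (cong (_% p) expand)
        where
        open ≡-Reasoning
        fd = allFin d
        ta : Fin d → ℕ
        ta i = toℕ (V.lookup a i)
        tx : Fin d → ℕ
        tx j = toℕ (V.lookup x j)
        wk : Fin d → ℕ
        wk k = w (compAt k)
        Tm : Fin d → Fin d → Fin d → ℕ
        Tm i j k = ta i * tx j * count (compAt k) (products i j)
        S : Fin d → ℕ
        S k = sum (concatMap (λ i → map (λ j → Tm i j k) fd) fd)
        expand : sum (map (λ k → wk k * S k) fd) ≡ χ w a * χ w x
        expand = begin
          sum (map (λ k → wk k * S k) fd)
            ≡⟨ sum-map-cong (λ k → cong (wk k *_) (sum-concatMap (λ i → map (λ j → Tm i j k) fd) fd)) fd ⟩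
          sum (map (λ k → wk k * sum (map (λ i → sum (map (λ j → Tm i j k) fd)) fd)) fd)
            ≡⟨ sum-map-cong (λ k → trans (sum-map-*ˡ (wk k) _ fd) (sum-map-cong (λ i → sum-map-*ˡ (wk k) _ fd) fd)) fd ⟩
          sum (map (λ k → sum (map (λ i → sum (map (λ j → wk k * Tm i j k) fd)) fd)) fd)
            ≡⟨ sum-swap (λ k i → sum (map (λ j → wk k * Tm i j k) fd)) fd fd ⟩
          sum (map (λ i → sum (map (λ k → sum (map (λ j → wk k * Tm i j k) fd)) fd)) fd)
            ≡⟨ sum-map-cong (λ i → sum-swap (λ k j → wk k * Tm i j k) fd fd) fd ⟩
          sum (map (λ i → sum (map (λ j → sum (map (λ k → wk k * Tm i j k) fd)) fd)) fd)
            ≡⟨ sum-map-cong (λ i → sum-map-cong (λ j → χ-scaled-basis-product (ta i) (tx j) i j) fd) fd ⟩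
          sum (map (λ i → sum (map (λ j → (wk i * ta i) * (wk j * tx j)) fd)) fd)
            ≡⟨ sum-map-cong (λ i → sym (sum-map-*ˡ (wk i * ta i) (λ j → wk j * tx j) fd)) fd ⟩
          sum (map (λ i → (wk i * ta i) * χ w x) fd)
            ≡⟨ sym (sum-map-*ʳ (χ w x) (λ i → wk i * ta i) fd) ⟩
          χ w a * χ w x ∎

  -- The kernel of a unital multiplicative χ_w is a maximal left ideal, hence
  -- contains the radical.  Maximality: if I ⊋ ker χ_w contains x with
  -- χ_w(x) = c ≢ 0, then y = c⁻¹x ∈ I and 1 - y ∈ ker χ_w ⊆ I, so 1 ∈ I.
  module Kernel (w : List ℕ → ℕ) (χ-* : ∀ a x → χ w (a *ₑ x) ≡ₚ χ w a * χ w x) (χ-1 : χ w 1# ≡ₚ 1) where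

    ker : Elem → Bool
    ker x = χ w x % p ≡ᵇ 0

    ker-intro : ∀ x → χ w x ≡ₚ 0 → ker x ≡ true
    ker-intro x e = IsTrue⇒≡true (≡⇒≡ᵇ (χ w x % p) 0 (trans e 0%p))

    ker-elim : ∀ x → ker x ≡ true → χ w x ≡ₚ 0
    ker-elim x e = trans (≡ᵇ-sound {χ w x % p} {0} e) (sym 0%p)

    ker-isLeftIdeal : IsLeftIdeal ker
    ker-isLeftIdeal = record
      { zero-mem = ker-intro 0# (cong (_% p) (χ-0 w))
      ; +-closed = λ x y kx ky → ker-intro (x +ₑ y) (trans (χ-+ w x y) (≡ₚ-+ {χ w x} {0} {χ w y} {0} (ker-elim x kx) (ker-elim y ky)))
      ; *-closed = λ a x kx → ker-intro (a *ₑ x)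
          (trans (χ-* a x) (trans (≡ₚ-* {χ w a} {χ w a} {χ w x} {0} refl (ker-elim x kx)) (cong (_% p) (*-zeroʳ (χ w a)))))
      }

    ker-proper : ker 1# ≡ false
    ker-proper = ≡ᵇ-≢ (λ e → 0≢1+n (sym (trans (sym 1%p) (trans (sym χ-1) e))))

    ker-maximal : ∀ I → IsLeftIdeal I → ker ⊆ᵇ I → (I ⊆ᵇ ker) ⊎ (I 1# ≡ true)
    ker-maximal I isI sub with I 1# in I1
    ... | true = inj₂ refl
    ... | false = inj₁ (λ x Ix → by-cases x Ix (χ w x % p ≟ 0))
      where
      by-cases : ∀ x → I x ≡ true → Dec (χ w x % p ≡ 0) → ker x ≡ true
      by-cases x Ix (yes z) = ker-intro x (trans z (sym 0%p))
      by-cases x Ix (no c≢0) = ⊥-elim (false≢true (trans (sym I1) 1∈I))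
        where
        false≢true : false ≢ true
        false≢true ()
        u = proj₁ (inverse (χ w x) c≢0)
        a = fp u ·ₑ 1#
        y = a *ₑ x
        χa : χ w a ≡ₚ u * 1
        χa = trans (χ-· w (fp u) 1#) (≡ₚ-* {toℕ (fp u)} {u} {χ w 1#} {1} (toℕ-mod-≡ₚ u) χ-1)
        χy : χ w y ≡ₚ 1
        χy = trans (χ-* a x) (trans (≡ₚ-* {χ w a} {u * 1} {χ w x} {χ w x} χa refl)
               (trans (cong (λ t → (t * χ w x) % p) (*-identityʳ u)) (proj₂ (inverse (χ w x) c≢0))))
        χ[1-y] : χ w (1# -ₑ y) ≡ₚ 0
        χ[1-y] = 1+t≡1⇒t≡0 (χ w (1# -ₑ y)) (trans (≡ₚ-+ {1} {χ w y} {χ w (1# -ₑ y)} {χ w (1# -ₑ y)} (sym χy) refl)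
                   (trans (sym (χ-+ w y (1# -ₑ y))) (trans (cong (λ v → χ w v % p) (y+[v-y]≡v y 1#)) χ-1)))
        1∈I : I 1# ≡ true
        1∈I = subst (λ v → I v ≡ true) (y+[v-y]≡v y 1#)
                (IsLeftIdeal.+-closed isI y (1# -ₑ y) (IsLeftIdeal.*-closed isI a x Ix) (sub (1# -ₑ y) (ker-intro (1# -ₑ y) χ[1-y])))

    ker-isMaximal : IsMaximalLeftIdeal ker
    ker-isMaximal = record { isLeftIdeal = ker-isLeftIdeal ; proper = ker-proper ; maximal = ker-maximal }

    radical⊆ker : ∀ x → Rad x → χ w x ≡ₚ 0
    radical⊆ker x r = ker-elim x (r ker ker-isMaximal)

-- Membership in Y_m and in T.  An element is written as an explicit
-- combination of generators, checked coordinate by coordinate.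
module Spans (n p : ℕ) (pp : Prime p) (n≥1 : 1 ≤ n) where
  open Sigma n p pp
  open Functional n p pp n≥1

  Combination : (Elem → Set) → Set
  Combination G = List (Fp × Σ Elem G)

  combine : {G : Elem → Set} → Combination G → Elem
  combine [] = 0#
  combine ((c , g , _) ∷ L) = (c ·ₑ g) +ₑ combine L

  -- Defs.Span folds with an anonymous function that computes like combine
  foldr≡combine : {G : Elem → Set} (F : Fp × Σ Elem G → Elem → Elem) →
    (∀ c g pf acc → F (c , g , pf) acc ≡ (c ·ₑ g) +ₑ acc) → ∀ L → L.foldr F 0# L ≡ combine L
  foldr≡combine F h [] = refl
  foldr≡combine F h ((c , g , pf) ∷ L) = trans (h c g pf _) (cong ((c ·ₑ g) +ₑ_) (foldr≡combine F h L))

  combine-Span : {G : Elem → Set} {x : Elem} (L : Combination G) → x ≡ combine L → Span G x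
  combine-Span L e = L , trans e (sym (foldr≡combine _ (λ c g pf acc → refl) L))

  entryAt : {G : Elem → Set} → Fin d → Fp × Σ Elem G → ℕ
  entryAt j (c , g , _) = toℕ c * toℕ (V.lookup g j)

  coord : {G : Elem → Set} → Combination G → Fin d → ℕ
  coord L j = sum (map (entryAt j) L)

  combine-coord : {G : Elem → Set} (L : Combination G) (j : Fin d) → toℕ (V.lookup (combine L) j) ≡ₚ coord L j
  combine-coord [] j = cong (_% p) (trans (cong toℕ (VP.lookup-replicate j (fp 0))) toℕ-fp0)
  combine-coord ((c , g , pf) ∷ L) j =
    trans (toℕ-+ₑ (c ·ₑ g) (combine L) j)
      (≡ₚ-+ {toℕ (V.lookup (c ·ₑ g) j)} {toℕ c * toℕ (V.lookup g j)}
         (trans (cong (λ z → toℕ z % p) (VP.lookup-map j _ g)) (toℕ-mod-≡ₚ _)) (combine-coord L j))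

  combine-from-coord : (v : Elem) {G : Elem → Set} (L : Combination G) → (∀ j → toℕ (V.lookup v j) ≡ₚ coord L j) → v ≡ combine L
  combine-from-coord v L h = Elem-ext-≡ₚ (λ j → trans (h j) (sym (combine-coord L j)))

  collect : {G : Elem → Set} (Ls : List (List ℕ)) → (∀ {e} → e ∈ Ls → e ∈ comps n) →
    ((e : List ℕ) → e ∈ comps n → Combination G) → Combination G
  collect [] sub f = []
  collect (e ∷ Ls) sub f = f e (sub (here refl)) ++ collect Ls (λ z → sub (there z)) f

  coord-collect : {G : Elem → Set} (Ls : List (List ℕ)) (sub : ∀ {e} → e ∈ Ls → e ∈ comps n)
    (f : (e : List ℕ) → e ∈ comps n → Combination G) (g : List ℕ → ℕ) (j : Fin d) →
    (∀ e e∈ → coord (f e e∈) j ≡ₚ g e) → coord (collect Ls sub f) j ≡ₚ sum (map g Ls)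
  coord-collect [] sub f g j h = refl
  coord-collect (e ∷ Ls) sub f g j h =
    trans (cong (_% p) (trans (cong sum (map-++ (entryAt j) (f e e∈) rest)) (sum-++ (map (entryAt j) (f e e∈)) _)))
      (≡ₚ-+ {coord (f e e∈) j} {g e} {coord rest j} (h e e∈) (coord-collect Ls (λ z → sub (there z)) f g j h))
    where
    e∈ = sub (here refl)
    rest = collect Ls (λ z → sub (there z)) f

  elemOf : (List ℕ → ℕ) → Elem
  elemOf F = V.tabulate (λ k → fp (F (compAt k)))

  toℕ-elemOf : ∀ F j → toℕ (V.lookup (elemOf F) j) ≡ₚ F (compAt j)
  toℕ-elemOf F j = trans (cong (λ z → toℕ z % p) (VP.lookup∘tabulate (λ k → fp (F (compAt k))) j)) (toℕ-mod-≡ₚ _)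

  coord-single : ∀ (F : List ℕ → ℕ) e j → toℕ (fp (F e)) * toℕ (V.lookup (B e) j) + 0 ≡ₚ F e * indL e (compAt j)
  coord-single F e j = trans (cong (_% p) (+-identityʳ _))
    (≡ₚ-* {toℕ (fp (F e))} {F e} {toℕ (V.lookup (B e) j)} {indL e (compAt j)} (toℕ-mod-≡ₚ (F e)) (cong (_% p) (trans (toℕ-B e j) (indL-sym (compAt j) e))))

  GenY : ℕ → Elem → Set
  GenY m g = Σ (List ℕ) λ q → q ∈ comps n × m ≤ length q × g ≡ B q

  blockY : (m : ℕ) (F : List ℕ → ℕ) (e : List ℕ) → e ∈ comps n → (b : Bool) → (IsTrue b → m ≤ length e) → Combination (GenY m)
  blockY m F e e∈ true le = (fp (F e) , B e , e , e∈ , le tt , refl) ∷ []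
  blockY m F e e∈ false _ = []

  coord-blockY : ∀ m F e e∈ b le j → coord (blockY m F e e∈ b le) j ≡ₚ ind b (F e) * indL e (compAt j)
  coord-blockY m F e e∈ true le j = coord-single F e j
  coord-blockY m F e e∈ false le j = refl

  elemOf-Y : ∀ m F → (∀ c → ¬ (m ≤ length c) → F c ≡ 0) → Y m (elemOf F)
  elemOf-Y m F h = combine-Span L (combine-from-coord _ L coords)
    where
    termY : (e : List ℕ) → e ∈ comps n → Combination (GenY m)
    termY e e∈ = blockY m F e e∈ (m ≤ᵇ length e) (≤ᵇ⇒≤ m (length e))
    L = collect (comps n) (λ z → z) termY
    F′ : List ℕ → ℕ
    F′ c = ind (m ≤ᵇ length c) (F c)
    F′≡F : ∀ c → F′ c ≡ F c
    F′≡F c with m ≤? length c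
    ... | yes le rewrite IsTrue⇒≡true (≤⇒≤ᵇ le) = refl
    ... | no nle rewrite ¬IsTrue⇒≡false (λ t → nle (≤ᵇ⇒≤ m (length c) t)) = sym (h c nle)
    coords : ∀ j → toℕ (V.lookup (elemOf F) j) ≡ₚ coord L j
    coords j = trans (toℕ-elemOf F j) (sym (trans
      (coord-collect (comps n) (λ z → z) termY (λ e → F′ e * indL e (compAt j)) j
        (λ e e∈ → coord-blockY m F e e∈ (m ≤ᵇ length e) (≤ᵇ⇒≤ m (length e)) j))
      (cong (_% p) (trans (sum-indL F′ (compAt j) (comps n))
        (trans (cong (F′ (compAt j) *_) (count-compAt j)) (trans (*-identityʳ _) (F′≡F (compAt j))))))))

  swap2 : List ℕ → List ℕ
  swap2 (a ∷ b ∷ []) = b ∷ a ∷ []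
  swap2 c = c

  swap2-involutive : ∀ c → swap2 (swap2 c) ≡ c
  swap2-involutive [] = refl
  swap2-involutive (a ∷ []) = refl
  swap2-involutive (a ∷ b ∷ []) = refl
  swap2-involutive (a ∷ b ∷ c ∷ r) = refl

  swap2-composition : ∀ c → Positive c × sum c ≡ n → Positive (swap2 c) × sum (swap2 c) ≡ n
  swap2-composition [] h = h
  swap2-composition (a ∷ []) h = h
  swap2-composition (a ∷ b ∷ []) (pa ∷ pb ∷ [] , s) =
    (pb ∷ pa ∷ []) , trans (cong (b +_) (+-identityʳ a)) (trans (+-comm b a) (trans (cong (a +_) (sym (+-identityʳ b))) s))
  swap2-composition (a ∷ b ∷ c ∷ r) h = h

  swap2-∈ : ∀ {e} → e ∈ comps n → swap2 e ∈ comps n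
  swap2-∈ {e} e∈ with swap2-composition e (All.lookup (comps-sound n n) e∈)
  ... | (pe , se) = count≥1⇒∈ (swap2 e) (comps n) (≤-reflexive (sym (count-comps _ pe se)))

  indL-swap2 : ∀ c e → indL c (swap2 e) ≡ indL e (swap2 c)
  indL-swap2 c e = by-cases (≡-dec _≟_ c (swap2 e))
    where
    by-cases : Dec (c ≡ swap2 e) → indL c (swap2 e) ≡ indL e (swap2 c)
    by-cases (yes eq) = trans (cong (indL c) (sym eq)) (trans (indL-yes c) (sym (trans
      (cong (λ z → indL z (swap2 c)) (trans (sym (swap2-involutive e)) (cong swap2 (sym eq)))) (indL-yes (swap2 c)))))
    by-cases (no ne) = trans (indL-no c (swap2 e) ne)
      (sym (indL-no e (swap2 c) (λ eq → ne (trans (sym (swap2-involutive c)) (cong swap2 (sym eq))))))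

  GenT : Elem → Set
  GenT g = Σ (List ℕ) λ q → Σ (List ℕ) λ r → q ∈ comps n × r ∈ comps n × q ↭ r × g ≡ (B q -ₑ B r)

  toℕ-B-B : ∀ q r j → toℕ (V.lookup (B q -ₑ B r) j) ≡ₚ indL (compAt j) q + (p ∸ 1) * indL (compAt j) r
  toℕ-B-B q r j = trans (cong (λ z → toℕ z % p) (VP.lookup-zipWith _ j (B q) (B r)))
     (trans (toℕ-mod-≡ₚ _) (trans (cong (λ z → (toℕ (V.lookup (B q) j) + (p ∸ z)) % p) (toℕ-B r j))
       (trans (cong (λ z → (z + (p ∸ indL (compAt j) r)) % p) (toℕ-B q j))
         (≡ₚ-+ {indL (compAt j) q} refl (negate (eqL (compAt j) r))))))
    where
    negate : ∀ b → p ∸ ind b 1 ≡ₚ (p ∸ 1) * ind b 1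
    negate true = cong (_% p) (sym (*-identityʳ (p ∸ 1)))
    negate false = trans (n%n≡0 p) (trans (sym 0%p) (cong (_% p) (sym (*-zeroʳ (p ∸ 1)))))

  -- [s,t] is the chosen representative of {[s,t],[t,s]} when s < t
  increasing : List ℕ → Bool
  increasing (s ∷ t ∷ []) = s <ᵇ t
  increasing _ = false

  blockT : (F : List ℕ → ℕ) (e : List ℕ) → e ∈ comps n → Combination GenT
  blockT F (s ∷ t ∷ []) e∈ with s <ᵇ t
  ... | true = (fp (F (s ∷ t ∷ [])) , (B (s ∷ t ∷ []) -ₑ B (t ∷ s ∷ [])) , (s ∷ t ∷ []) , (t ∷ s ∷ []) ,
                 e∈ , swap2-∈ e∈ , ↭-swap s t ↭-refl , refl) ∷ []
  ... | false = []
  blockT F [] e∈ = []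
  blockT F (a ∷ []) e∈ = []
  blockT F (a ∷ b ∷ c ∷ r) e∈ = []

  contributionT : List ℕ → List ℕ → ℕ → ℕ
  contributionT c e g = ind (increasing e) (g * (indL e c + (p ∸ 1) * indL c (swap2 e)))

  coord-blockT : ∀ F e e∈ j → coord (blockT F e e∈) j ≡ₚ contributionT (compAt j) e (F e)
  coord-blockT F (s ∷ t ∷ []) e∈ j with s <ᵇ t
  ... | true = trans (cong (_% p) (+-identityʳ _))
                 (trans (≡ₚ-* {toℕ (fp (F st))} {F st} (toℕ-mod-≡ₚ (F st)) (toℕ-B-B st ts j))
                   (cong (λ z → (F st * (z + (p ∸ 1) * indL (compAt j) ts)) % p) (indL-sym (compAt j) st)))
    where
    st = s ∷ t ∷ []
    ts = t ∷ s ∷ []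
  ... | false = refl
  coord-blockT F [] e∈ j = refl
  coord-blockT F (a ∷ []) e∈ j = refl
  coord-blockT F (a ∷ b ∷ c ∷ r) e∈ j = refl

  contributionT-split : ∀ b g A k B′ → ind b (g * (A + k * B′)) ≡ ind b g * A + k * (ind b g * B′)
  contributionT-split true g A k B′ =
    trans (*-distribˡ-+ g A (k * B′)) (cong (g * A +_) (trans (sym (*-assoc g k B′)) (trans (cong (_* B′) (*-comm g k)) (*-assoc k g B′))))
  contributionT-split false g A k B′ = sym (*-zeroʳ k)

  increasingPart : (List ℕ → ℕ) → List ℕ → ℕ
  increasingPart F c = ind (increasing c) (F c)

  sum-contributionT : ∀ F j → sum (map (λ e → contributionT (compAt j) e (F e)) (comps n)) ≡
    increasingPart F (compAt j) + (p ∸ 1) * increasingPart F (swap2 (compAt j))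
  sum-contributionT F j = begin
    sum (map (λ e → contributionT cj e (F e)) (comps n))
      ≡⟨ sum-map-cong (λ e → contributionT-split (increasing e) (F e) (indL e cj) (p ∸ 1) (indL cj (swap2 e))) (comps n) ⟩
    sum (map (λ e → H e * indL e cj + (p ∸ 1) * (H e * indL cj (swap2 e))) (comps n))
      ≡⟨ sum-map-+ (λ e → H e * indL e cj) (λ e → (p ∸ 1) * (H e * indL cj (swap2 e))) (comps n) ⟩
    sum (map (λ e → H e * indL e cj) (comps n)) + sum (map (λ e → (p ∸ 1) * (H e * indL cj (swap2 e))) (comps n))
      ≡⟨ cong₂ _+_ (trans (sum-indL H cj (comps n)) (trans (cong (H cj *_) (count-compAt j)) (*-identityʳ _)))
                    (sym (sum-map-*ˡ (p ∸ 1) (λ e → H e * indL cj (swap2 e)) (comps n))) ⟩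
    H cj + (p ∸ 1) * sum (map (λ e → H e * indL cj (swap2 e)) (comps n))
      ≡⟨ cong (λ z → H cj + (p ∸ 1) * z) (trans (sum-map-cong (λ e → cong (H e *_) (indL-swap2 cj e)) (comps n))
            (trans (sum-indL H (swap2 cj) (comps n)) (trans (cong (H (swap2 cj) *_) (count-comps (swap2 cj) (proj₁ sw) (proj₂ sw)))
              (*-identityʳ _)))) ⟩
    H cj + (p ∸ 1) * H (swap2 cj) ∎
    where
    open ≡-Reasoning
    H = increasingPart F
    cj = compAt j
    sw = swap2-composition cj (compAt-composition j)

  -- Σ_q F(q) B_q ∈ T when F lives on two-part compositions, is
  -- antisymmetric F[s,t] = -F[t,s], and vanishes on the diagonal [s,s]:
  -- it is then Σ_{s<t} F[s,t] (B_[s,t] - B_[t,s]).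
  elemOf-T : ∀ (F : List ℕ → ℕ) →
    (∀ c → length c ≢ 2 → F c ≡ 0) →
    (∀ s t → 1 ≤ s → 1 ≤ t → s + t ≡ n → s ≢ t → F (s ∷ t ∷ []) + F (t ∷ s ∷ []) ≡ₚ 0) →
    (∀ s → F (s ∷ s ∷ []) ≡ₚ 0) →
    T (elemOf F)
  elemOf-T F F-two F-antisym F-diag = combine-Span L (combine-from-coord _ L coords)
    where
    L = collect (comps n) (λ z → z) (blockT F)
    H = increasingPart F
    -- F(c) = H(c) - H(swap c): only the increasing representative carries a generator
    F-split : ∀ c → Positive c × sum c ≡ n → F c ≡ₚ H c + (p ∸ 1) * H (swap2 c)
    F-split [] _ rewrite F-two [] (λ ()) | *-zeroʳ (p ∸ 1) = refl
    F-split (a ∷ []) _ rewrite F-two (a ∷ []) (λ ()) | *-zeroʳ (p ∸ 1) = refl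
    F-split (a ∷ b ∷ c ∷ r) _ rewrite F-two (a ∷ b ∷ c ∷ r) (λ ()) | *-zeroʳ (p ∸ 1) = refl
    F-split (s ∷ t ∷ []) (ps ∷ pt ∷ [] , sm) with <-cmp s t
    ... | tri< lt _ _ rewrite <ᵇ-complete lt | ¬IsTrue⇒≡false (λ x → <⇒≯ lt (<ᵇ⇒< t s x)) | *-zeroʳ (p ∸ 1) =
          cong (_% p) (sym (+-identityʳ _))
    ... | tri≈ _ refl _ rewrite ¬IsTrue⇒≡false (λ x → <-irrefl refl (<ᵇ⇒< s s x)) | *-zeroʳ (p ∸ 1) = F-diag s
    ... | tri> _ _ gt rewrite <ᵇ-complete gt | ¬IsTrue⇒≡false (λ x → <⇒≯ gt (<ᵇ⇒< s t x)) =
          a+b≡0⇒a≡-b (F (s ∷ t ∷ [])) (F (t ∷ s ∷ []))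
            (F-antisym s t ps pt (trans (cong (s +_) (sym (+-identityʳ t))) sm) (>⇒≢ gt))
    coords : ∀ j → toℕ (V.lookup (elemOf F) j) ≡ₚ coord L j
    coords j = trans (toℕ-elemOf F j) (trans (F-split (compAt j) (compAt-composition j))
      (trans (cong (_% p) (sym (sum-contributionT F j)))
        (sym (coord-collect (comps n) (λ z → z) (blockT F) (λ e → contributionT (compAt j) e (F e)) j
               (λ e e∈ → coord-blockT F e e∈ j)))))

module RadicalCharacters (n p : ℕ) (pp : Prime p) (n≥1 : 1 ≤ n) where
  open Sigma n p pp
  open Functional n p pp n≥1
  open Weights n

  indL-supported : ∀ c e → Positive e → sum e ≡ n → indL c e * count c (comps n) ≡ indL c e
  indL-supported c e pe se = by-cases (≡-dec _≟_ c e)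
    where
    by-cases : Dec (c ≡ e) → indL c e * count c (comps n) ≡ indL c e
    by-cases (yes refl) = trans (cong (indL c c *_) (count-comps c pe se)) (*-identityʳ _)
    by-cases (no ne) rewrite indL-no c e ne = refl

  whole-composition : Positive (n ∷ []) × sum (n ∷ []) ≡ n
  whole-composition = (n≥1 ∷ []) , +-identityʳ n

  radical-killed : (w : List ℕ → ℕ) →
    (∀ c → w c * count c (comps n) ≡ w c) →
    (∀ c → 3 ≤ length c → w c ≡ 0) → w (n ∷ []) ≡ 1 →
    (∀ x y u v → 1 ≤ x → 1 ≤ y → 1 ≤ u → 1 ≤ v → x + y ≡ n → u + v ≡ n →
       w (x ∷ y ∷ []) * w (u ∷ v ∷ []) ≡ w (x ∷ y ∷ []) * (ind (x ≡ᵇ u) 1 + ind (x ≡ᵇ v) 1)) →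
    ∀ x → Rad x → χ w x ≡ₚ 0
  radical-killed w w-supp w-long w-whole w-pairs = Kernel.radical⊆ker w χ-* χ-1
    where
    open ProductFormula n n≥1 w w-long w-whole w-pairs using (product-formula)
    open Multiplicative w w-supp product-formula using (χ-*)
    χ-1 : χ w 1# ≡ₚ 1
    χ-1 = cong (_% p) (trans (χ-B w (n ∷ []))
            (cong₂ _*_ w-whole (count-comps (n ∷ []) (proj₁ whole-composition) (proj₂ whole-composition))))

  radical-w₀ : ∀ x → Rad x → χ w₀ x ≡ₚ 0
  radical-w₀ = radical-killed w₀ (λ c → indL-supported c (n ∷ []) (proj₁ whole-composition) (proj₂ whole-composition))
                 w₀-long w₀-whole w₀-pairs

  radical-wPair : ∀ a → 1 ≤ a → a < n → ∀ x → Rad x → χ (wPair a) x ≡ₚ 0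
  radical-wPair a 1≤a a<n = radical-killed (wPair a) supported (wPair-long a) (wPair-whole a) (wPair-pairs a (<⇒≤ a<n))
    where
    b = n ∸ a
    ab : sum (a ∷ b ∷ []) ≡ n
    ab = trans (cong (a +_) (+-identityʳ b)) (m+[n∸m]≡n (<⇒≤ a<n))
    ba : sum (b ∷ a ∷ []) ≡ n
    ba = trans (cong (b +_) (+-identityʳ a)) (trans (+-comm b a) (m+[n∸m]≡n (<⇒≤ a<n)))
    supported : ∀ c → wPair a c * count c (comps n) ≡ wPair a c
    supported c = trans (*-distribʳ-+ (count c (comps n)) (indL c (n ∷ [])) _)
      (cong₂ _+_ (indL-supported c (n ∷ []) (proj₁ whole-composition) (proj₂ whole-composition))
        (trans (*-distribʳ-+ (count c (comps n)) (indL c (a ∷ b ∷ [])) _)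
          (cong₂ _+_ (indL-supported c _ (1≤a ∷ m<n⇒0<n∸m a<n ∷ []) ab) (indL-supported c _ (m<n⇒0<n∸m a<n ∷ 1≤a ∷ []) ba))))

module Decomposition (n p : ℕ) (pp : Prime p) (n≥1 : 1 ≤ n) (x : Sigma.Elem n p pp) (rx : Sigma.Rad n p pp x) where
  open Sigma n p pp
  open Functional n p pp n≥1
  open Spans n p pp n≥1
  open RadicalCharacters n p pp n≥1
  open Weights n

  xk : Fin d → ℕ
  xk k = toℕ (V.lookup x k)

  -- the coefficient x_c (zero if c is not a composition of n)
  coeff : List ℕ → ℕ
  coeff c = sum (map (λ k → indL (compAt k) c * xk k) (allFin d))

  coeff-compAt : ∀ j → coeff (compAt j) ≡ xk j
  coeff-compAt j = trans (sum-allFin-point d (λ k → indL (compAt k) (compAt j) * xk k) j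
      (λ k ne → cong (_* xk k) (indL-no (compAt k) (compAt j)
         (λ e → ne (lookup-injective (comps n) (λ i → ≤-reflexive (count-compAt i)) k j e)))))
    (trans (cong (_* xk j) (indL-yes (compAt j))) (+-identityʳ (xk j)))

  coeff-non-composition : ∀ c → sum c ≢ n → coeff c ≡ 0
  coeff-non-composition c ns = sum-map-zero _ (allFin d) (All.universal (λ k →
     cong (_* xk k) (indL-no (compAt k) c (λ e → ns (trans (cong sum (sym e)) (proj₂ (compAt-composition k)))))) (allFin d))

  -- χ_{w₀}(x) = x_[n]
  coeff-whole : coeff (n ∷ []) ≡ₚ 0
  coeff-whole = radical-w₀ x rx

  χ-wPair : ∀ a → χ (wPair a) x ≡ coeff (n ∷ []) + (coeff (a ∷ n ∸ a ∷ []) + coeff (n ∸ a ∷ a ∷ []))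
  χ-wPair a = trans (sum-map-cong (λ k → trans (*-distribʳ-+ (xk k) (indL (compAt k) (n ∷ [])) _)
                 (cong (indL (compAt k) (n ∷ []) * xk k +_) (*-distribʳ-+ (xk k) (indL (compAt k) (a ∷ n ∸ a ∷ [])) _))) (allFin d))
           (trans (sum-map-+ _ _ (allFin d)) (cong (coeff (n ∷ []) +_) (sum-map-+ _ _ (allFin d))))

  -- χ_{w_s}(x) = x_[n] + x_[s,t] + x_[t,s] with x_[n] = 0
  coeff-antisym : ∀ s t → 1 ≤ s → 1 ≤ t → s + t ≡ n → coeff (s ∷ t ∷ []) + coeff (t ∷ s ∷ []) ≡ₚ 0
  coeff-antisym s t 1≤s 1≤t e = begin
      pairSum % p ≡⟨ ≡ₚ-+ {0} {coeff (n ∷ [])} {pairSum} {pairSum} (sym coeff-whole) refl ⟩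
      (coeff (n ∷ []) + pairSum) % p ≡⟨ cong (_% p) (sym (subst (λ z → χ (wPair s) x ≡ coeff (n ∷ []) + (coeff (s ∷ z ∷ []) + coeff (z ∷ s ∷ []))) n∸s (χ-wPair s))) ⟩
      χ (wPair s) x % p ≡⟨ radical-wPair s 1≤s s<n x rx ⟩
      0 % p ∎
    where
    open ≡-Reasoning
    pairSum = coeff (s ∷ t ∷ []) + coeff (t ∷ s ∷ [])
    n∸s : n ∸ s ≡ t
    n∸s = trans (cong (_∸ s) (sym e)) (m+n∸m≡n s t)
    s<n : s < n
    s<n = subst (s <_) e (m<m+n s 1≤t)

  longPart : List ℕ → ℕ
  longPart c = ind (3 ≤ᵇ length c) (coeff c)

  longPart∈Y₃ : Y 3 (elemOf longPart)
  longPart∈Y₃ = elemOf-Y 3 longPart (λ c nle → cong (λ z → ind z (coeff c)) (¬IsTrue⇒≡false (λ t → nle (≤ᵇ⇒≤ 3 (length c) t))))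

  twoParts : (List ℕ → ℕ) → Set
  twoParts U = (∀ a b → U (a ∷ b ∷ []) ≡ coeff (a ∷ b ∷ [])) × (∀ c → length c ≢ 2 → U c ≡ 0)

  -- x = (two-part component) + (component with ≥ 3 parts), using x_[n] = 0
  x≡twoPart+longPart : (a : Elem) (U : List ℕ → ℕ) → (∀ j → toℕ (V.lookup a j) ≡ₚ U (compAt j)) → twoParts U →
    x ≡ a +ₑ elemOf longPart
  x≡twoPart+longPart a U a≡U (U-two , U-other) = Elem-ext-≡ₚ λ j →
    trans (cong (_% p) (sym (coeff-compAt j)))
      (trans (by-length (compAt j) (compAt-composition j))
        (sym (trans (toℕ-+ₑ a (elemOf longPart) j) (≡ₚ-+ {toℕ (V.lookup a j)} (a≡U j) (toℕ-elemOf longPart j)))))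
    where
    by-length : ∀ c → Positive c × sum c ≡ n → coeff c ≡ₚ U c + longPart c
    by-length [] (_ , s) = ⊥-elim (<⇒≢ n≥1 s)
    by-length (a ∷ []) (_ , s) rewrite U-other (a ∷ []) (λ ()) =
      subst (λ z → coeff (z ∷ []) ≡ₚ 0) (sym (trans (sym (+-identityʳ a)) s)) coeff-whole
    by-length (a ∷ b ∷ []) _ rewrite U-two a b = cong (_% p) (sym (+-identityʳ _))
    by-length (a ∷ b ∷ c ∷ r) _ rewrite U-other (a ∷ b ∷ c ∷ r) (λ ()) = refl

  -- If n is odd or p ≠ 2, the diagonal coefficients x_[s,s] vanish
  -- (2 x_[s,s] = 0), so the whole two-part component lies in Y₂ ∩ T.
  module OddCase (h : (¬ (2 ∣ n)) ⊎ (p ≢ 2)) where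

    -- x_[s,s] = 0: either [s,s] is not a composition of n, or n = 2s is
    -- even, so p ≠ 2 and 2 x_[s,s] = 0 forces x_[s,s] = 0
    coeff-diag : ∀ s → coeff (s ∷ s ∷ []) ≡ₚ 0
    coeff-diag s with s + (s + 0) ≟ n
    ... | no ns = cong (_% p) (coeff-non-composition (s ∷ s ∷ []) ns)
    ... | yes e = by-hypothesis h
      where
      1≤s : 1 ≤ s
      1≤s = positive s e
        where
        positive : ∀ s → s + (s + 0) ≡ n → 1 ≤ s
        positive zero e = ⊥-elim (<⇒≢ n≥1 e)
        positive (suc _) _ = s≤s z≤n
      twice : coeff (s ∷ s ∷ []) + coeff (s ∷ s ∷ []) ≡ₚ 0
      twice = coeff-antisym s s 1≤s 1≤s (trans (cong (s +_) (sym (+-identityʳ s))) e)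
      by-hypothesis : (¬ (2 ∣ n)) ⊎ (p ≢ 2) → coeff (s ∷ s ∷ []) ≡ₚ 0
      by-hypothesis (inj₁ n-odd) = ⊥-elim (n-odd (divides s (trans (sym e) (*-comm 2 s))))
      by-hypothesis (inj₂ p≢2)
        with euclidsLemma 2 (coeff (s ∷ s ∷ [])) pp
               (m%n≡0⇒n∣m _ p (trans (cong (_% p) (cong (coeff (s ∷ s ∷ []) +_) (+-identityʳ _))) (trans twice 0%p)))
      ... | inj₁ p∣2 = ⊥-elim (p≢2 (≤-antisym (∣⇒≤ p∣2) p>1))
      ... | inj₂ p∣x = trans (n∣m⇒m%n≡0 _ p p∣x) (sym 0%p)

    twoPart : List ℕ → ℕ
    twoPart c = ind (length c ≡ᵇ 2) (coeff c)

    twoPart-other : ∀ c → length c ≢ 2 → twoPart c ≡ 0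
    twoPart-other c ne = cong (λ z → ind z (coeff c)) (≡ᵇ-≢ ne)

    twoPart∈Y₂∩T : (Y 2 ∩ T) (elemOf twoPart)
    twoPart∈Y₂∩T = elemOf-Y 2 twoPart (λ c nle → twoPart-other c (λ e → nle (≤-reflexive (sym e)))) ,
                   elemOf-T twoPart twoPart-other (λ s t ps pt e _ → coeff-antisym s t ps pt e) coeff-diag

    decomposition : ((Y 2 ∩ T) ⊕ Y 3) x
    decomposition = elemOf twoPart , elemOf longPart , twoPart∈Y₂∩T , longPart∈Y₃ ,
      x≡twoPart+longPart (elemOf twoPart) twoPart (toℕ-elemOf twoPart) ((λ a b → refl) , twoPart-other)

  module EvenCase (2∣n : 2 ∣ n) where

    middle : List ℕ
    middle = n / 2 ∷ n / 2 ∷ []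

    half-unique : ∀ s → s + s ≡ n → s ≡ n / 2
    half-unique s e = from-witness 2∣n
      where
      from-witness : 2 ∣ n → s ≡ n / 2
      from-witness (divides k eq) = trans (*-cancelʳ-≡ s k 2 (trans (trans (*-comm s 2) (cong (s +_) (*-identityˡ s))) (trans e eq)))
                                      (sym (trans (cong (_/ 2) eq) (m*n/n≡m k 2)))

    middlePart : List ℕ → ℕ
    middlePart c = ind (eqL c middle) (coeff c)

    otherPairs : List ℕ → ℕ
    otherPairs c = ind (length c ≡ᵇ 2) (ind (not (eqL c middle)) (coeff c))

    otherPairs-other : ∀ c → length c ≢ 2 → otherPairs c ≡ 0
    otherPairs-other c ne = cong (λ z → ind z (ind (not (eqL c middle)) (coeff c))) (≡ᵇ-≢ ne)

    middlePart-other : ∀ c → length c ≢ 2 → middlePart c ≡ 0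
    middlePart-other c ne = cong (λ z → ind z (coeff c)) (dec-false (≡-dec _≟_ c middle) (λ e → ne (cong length e)))

    -- the remaining coefficients are antisymmetric, since s ≠ t there
    otherPairs-antisym : ∀ s t → 1 ≤ s → 1 ≤ t → s + t ≡ n → s ≢ t → otherPairs (s ∷ t ∷ []) + otherPairs (t ∷ s ∷ []) ≡ₚ 0
    otherPairs-antisym s t ps pt e ne
      rewrite dec-false (≡-dec _≟_ (s ∷ t ∷ []) middle) (λ q → ne (trans (∷-injectiveˡ q) (sym (∷-injectiveˡ (∷-injectiveʳ q)))))
            | dec-false (≡-dec _≟_ (t ∷ s ∷ []) middle) (λ q → ne (trans (∷-injectiveˡ (∷-injectiveʳ q)) (sym (∷-injectiveˡ q))))
      = coeff-antisym s t ps pt e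

    -- the only diagonal composition of n is the middle one, which is excluded
    otherPairs-diag : ∀ s → otherPairs (s ∷ s ∷ []) ≡ₚ 0
    otherPairs-diag s with s ≟ n / 2
    ... | yes refl rewrite dec-true (≡-dec _≟_ middle middle) refl = refl
    ... | no ne rewrite coeff-non-composition (s ∷ s ∷ []) (λ e → ne (half-unique s (trans (cong (s +_) (sym (+-identityʳ s))) e))) =
          cong (_% p) (ind-0 (not (eqL (s ∷ s ∷ []) middle)))

    middlePart∈⟨B⟩ : ⟨ B middle ⟩ (elemOf middlePart)
    middlePart∈⟨B⟩ = combine-Span L (combine-from-coord (elemOf middlePart) L λ j →
        trans (toℕ-elemOf middlePart j) (trans (cong (_% p) (trans (as-multiple (compAt j))
          (trans (cong (coeff middle *_) (sym (toℕ-B middle j))) (sym (+-identityʳ _)))))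
        (≡ₚ-+ {coeff middle * toℕ (V.lookup (B middle) j)} {toℕ (fp (coeff middle)) * toℕ (V.lookup (B middle) j)} {0} {0}
          (≡ₚ-* {coeff middle} {toℕ (fp (coeff middle))} (sym (toℕ-mod-≡ₚ (coeff middle))) refl) refl)))
      where
      L : Combination (λ g → g ≡ B middle)
      L = (fp (coeff middle) , B middle , refl) ∷ []
      as-multiple : ∀ c → middlePart c ≡ coeff middle * indL c middle
      as-multiple c with ≡-dec _≟_ c middle
      ... | yes refl = sym (*-identityʳ _)
      ... | no ne = sym (*-zeroʳ (coeff middle))

    twoPart : List ℕ → ℕ
    twoPart c = middlePart c + otherPairs c

    twoPart-twoParts : twoParts twoPart
    twoPart-twoParts = pair , (λ c ne → cong₂ _+_ (middlePart-other c ne) (otherPairs-other c ne))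
      where
      pair : ∀ a b → twoPart (a ∷ b ∷ []) ≡ coeff (a ∷ b ∷ [])
      pair a b with eqL (a ∷ b ∷ []) middle
      ... | true = +-identityʳ _
      ... | false = refl

    decomposition : (⟨ B middle ⟩ ⊕ (Y 2 ∩ T) ⊕ Y 3) x
    decomposition = (elemOf middlePart +ₑ elemOf otherPairs) , elemOf longPart ,
      (elemOf middlePart , elemOf otherPairs , middlePart∈⟨B⟩ ,
        (elemOf-Y 2 otherPairs (λ c nle → otherPairs-other c (λ e → nle (≤-reflexive (sym e)))) ,
         elemOf-T otherPairs otherPairs-other otherPairs-antisym otherPairs-diag) , refl) ,
      longPart∈Y₃ ,
      x≡twoPart+longPart (elemOf middlePart +ₑ elemOf otherPairs) twoPart
        (λ j → trans (toℕ-+ₑ (elemOf middlePart) (elemOf otherPairs) j)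
                 (≡ₚ-+ {toℕ (V.lookup (elemOf middlePart) j)} (toℕ-elemOf middlePart j) (toℕ-elemOf otherPairs j)))
        twoPart-twoParts

mainTheorem10 : (n p : ℕ) (pp : Prime p) → 1 ≤ n →
    let open Sigma n p pp in
    (((¬ (2 ∣ n)) ⊎ (p ≢ 2)) → ∀ x → Rad x → ((Y 2 ∩ T) ⊕ Y 3) x)
    × (((2 ∣ n) × (p ≡ 2)) → ∀ x → Rad x →
        (⟨ B ((n / 2) ∷ (n / 2) ∷ []) ⟩ ⊕ (Y 2 ∩ T) ⊕ Y 3) x)
mainTheorem10 n p pp n≥1 =
  (λ h x rx → Decomposition.OddCase.decomposition n p pp n≥1 x rx h) ,
  (λ (2∣n , _) x rx → Decomposition.EvenCase.decomposition n p pp n≥1 x rx 2∣n)
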